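{- Let $\mathcal B,\mathcal B^*$ be matroids on a finite set $X$ and $B\mapsto B^*$ a linking $\mathcal B\to\mathcal B^*$; let $\omega,\pi,a,z,\varepsilon$ and $\sigma:\mathcal B\to\mathcal B$ be as in the context. Then for every $B\in\mathcal B$, $$|\varphi_\omega^{ -1}(B)|=|\varphi_\pi^{ -1}(\sigma(B))|\quad\text{and}\quad|(\varphi^*_\omega)^{ -1}(B^*)|=|(\varphi^*_\pi)^{ -1}(\sigma(B)^*)|.$$
   Context: A pre-matroid on a finite set $X$ is a non-empty set of subsets of $X$ (bases). For $Y\subseteq X$, $x\notin Y$, $Y+x=Y\cup\{x\}$; for $y\in Y$, $Y-y=Y\setminus\{y\}$. An almost-basis of a pre-matroid $\mathcal C$ is $B-x$ with $B\in\mathcal C$, $x\in B$; $U(D)=\{x\notin D: D+x\in\mathcal C\}$. A matroid is a pre-matroid such that for all bases $B_1,B_2$ and $x\in B_1\setminus B_2$ there is $y\in B_2\setminus B_1$ with $B_1-x+y$ a basis. A transposition exchanges two distinct elements of $X$ and fixes the rest; it acts on subsets elementwise. A bijection $\mathcal B\to\mathcal B^*$, $B\mapsto B^*$, is a linking if for all $B\in\mathcal B$ and transpositions $\tau$: (L1) if $\tau(B)\in\mathcal B$ then $\tau(B^*)\in\mathcal B^*$ and $\tau(B^*)=\tau(B)^*$; (L2) if $\tau(B^*)\in\mathcal B^*$ then $\tau(B)\in\mathcal B$ and $\tau(B^*)=\tau(B)^*$. For a linear order $\rho$, $\varphi_\rho$ maps an almost-basis $D$ of $\mathcal B$ to $D+\min_\rho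 U(D)$ computed in $\mathcal B$, and $\varphi^*_\rho$ is the same map for almost-bases of $\mathcal B^*$ computed in $\mathcal B^*$. Let $\omega$ be a linear order on $X$, $a\ne z$ consecutive for $\omega$ with $a<_\omega z$, $\varepsilon$ the transposition of $a,z$, and $\pi$ the linear order agreeing with $\omega$ except $z<_\pi a$. An almost-basis $D$ (of either pre-matroid) is branching if its images under the $\omega$- and $\pi$-maps differ. A basis is a branching image if it is the image under the $\omega$- or $\pi$-map of some branching almost-basis of the same pre-matroid. For $B\in\mathcal B$ let $\varepsilon_B=\varepsilon$ if $B$ is a branching image in $\mathcal B$ or $B^*$ is a branching image in $\mathcal B^*$, and $\varepsilon_B=\mathrm{id}_X$ otherwise; put $\sigma(B)=\varepsilon_B(B)$ (this lies in $\mathcal B$). -}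

module Defs where

open import Data.Nat using (ℕ; suc; _<_; _≤_)
open import Data.Bool using (Bool; true; false; _∧_; _∨_; not; if_then_else_)
import Data.Bool as Bool
open import Data.Fin using (Fin; toℕ)
open import Data.Fin.Subset using (Subset; ⁅_⁆; _∪_; _-_; _∈_; _∉_)
open import Data.Fin.Permutation using (Permutation′; _⟨$⟩ʳ_)
import Data.Fin.Permutation.Components as PC
open import Data.List using (List; []; _∷_; _++_; map; filterᵇ; length; foldr; allFin)
open import Data.Bool.ListAction using (any)
open import Data.Maybe using (Maybe; just; nothing)
import Data.Maybe.Properties as MP
open import Data.Vec using (Vec; []; _∷_; lookup; tabulate)
import Data.Vec.Properties as VP
open import Data.Product using (Σ; _×_; ∃; ∃-syntax)
open import Data.Sum using (_⊎_)
open import Relation.Nullary using (¬_; ⌊_⌋)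
open import Relation.Binary.PropositionalEquality using (_≡_; _≢_)

SetFamily : ℕ → Set
SetFamily n = Subset n → Bool

_∈ᶠ_ : ∀ {n} → Subset n → SetFamily n → Set
B ∈ᶠ 𝓒 = 𝓒 B ≡ true

NonEmpty : ∀ {n} → SetFamily n → Set
NonEmpty {n} 𝓒 = ∃[ B ] (B ∈ᶠ 𝓒)

_⊕_ : ∀ {n} → Subset n → Fin n → Subset n
Y ⊕ x = Y ∪ ⁅ x ⁆

IsMatroid : ∀ {n} → SetFamily n → Set
IsMatroid {n} 𝓑 =
  NonEmpty 𝓑 ×
  (∀ (B₁ B₂ : Subset n) (x : Fin n) → B₁ ∈ᶠ 𝓑 → B₂ ∈ᶠ 𝓑 → x ∈ B₁ → x ∉ B₂ →
     ∃[ y ] (y ∈ B₂ × y ∉ B₁ × ((B₁ - x) ⊕ y) ∈ᶠ 𝓑))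

eqS : ∀ {n} → Subset n → Subset n → Bool
eqS u v = ⌊ VP.≡-dec Bool._≟_ u v ⌋

eqM : ∀ {n} → Maybe (Subset n) → Maybe (Subset n) → Bool
eqM u v = ⌊ MP.≡-dec (VP.≡-dec Bool._≟_) u v ⌋

allSubsets : (n : ℕ) → List (Subset n)
allSubsets ℕ.zero = [] ∷ []
allSubsets (suc n) = map (true ∷_) (allSubsets n) ++ map (false ∷_) (allSubsets n)

-- D is an almost-basis: D = B - x with B ∈ 𝓒 and x ∈ B,
-- i.e. (unfolding, with B = D + x) there is x ∉ D with D + x ∈ 𝓒.
isAlmostBasis : ∀ {n} → SetFamily n → Subset n → Bool
isAlmostBasis {n} 𝓒 D = any (λ x → not (lookup D x) ∧ 𝓒 (D ⊕ x)) (allFin n)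

U : ∀ {n} → SetFamily n → Subset n → List (Fin n)
U {n} 𝓒 D = filterᵇ (λ x → not (lookup D x) ∧ 𝓒 (D ⊕ x)) (allFin n)

-- Linear orders on Fin n, represented by their rank bijection onto Fin n:
-- x <ρ y  iff  rank x < rank y.
LinOrder : ℕ → Set
LinOrder n = Permutation′ n

rank : ∀ {n} → LinOrder n → Fin n → ℕ
rank ρ x = toℕ (ρ ⟨$⟩ʳ x)

_<[_]_ : ∀ {n} → Fin n → LinOrder n → Fin n → Set
x <[ ρ ] y = rank ρ x < rank ρ y

minBy : ∀ {n} → LinOrder n → List (Fin n) → Maybe (Fin n)
minBy ρ = foldr step nothing
  where
  step : _ → _ → _
  step x nothing = just x
  step x (just y) = if ⌊ Data.Nat._<?_ (rank ρ x) (rank ρ y) ⌋ then just x else just y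

-- φ_ρ(D) = D + min_ρ U(D)  (defined, i.e. `just`, on almost-bases)
φ : ∀ {n} → LinOrder n → SetFamily n → Subset n → Maybe (Subset n)
φ ρ 𝓒 D with minBy ρ (U 𝓒 D)
... | nothing = nothing
... | just x  = just (D ⊕ x)

preimageCount : ∀ {n} → LinOrder n → SetFamily n → Subset n → ℕ
preimageCount {n} ρ 𝓒 B =
  length (filterᵇ (λ D → isAlmostBasis 𝓒 D ∧ eqM (φ ρ 𝓒 D) (just B)) (allSubsets n))

isBranching : ∀ {n} → LinOrder n → LinOrder n → SetFamily n → Subset n → Bool
isBranching ω π 𝓒 D = isAlmostBasis 𝓒 D ∧ not (eqM (φ ω 𝓒 D) (φ π 𝓒 D))

isBranchingImage : ∀ {n} → LinOrder n → LinOrder n → SetFamily n → Subset n → Bool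
isBranchingImage {n} ω π 𝓒 B =
  any (λ D → isBranching ω π 𝓒 D ∧ (eqM (φ ω 𝓒 D) (just B) ∨ eqM (φ π 𝓒 D) (just B)))
      (allSubsets n)

transposeSet : ∀ {n} → Fin n → Fin n → Subset n → Subset n
transposeSet i j Y = tabulate (λ x → lookup Y (PC.transpose i j x))

-- A linking 𝓑 → 𝓑*, B ↦ star B (star is a function on all subsets; only its
-- restriction to 𝓑 matters): a bijection 𝓑 → 𝓑* satisfying (L1), (L2).
IsLinking : ∀ {n} → SetFamily n → SetFamily n → (Subset n → Subset n) → Set
IsLinking {n} 𝓑 𝓑* star =
  (∀ B → B ∈ᶠ 𝓑 → star B ∈ᶠ 𝓑*) ×
  (∀ B₁ B₂ → B₁ ∈ᶠ 𝓑 → B₂ ∈ᶠ 𝓑 → star B₁ ≡ star B₂ → B₁ ≡ B₂) ×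
  (∀ C → C ∈ᶠ 𝓑* → ∃[ B ] (B ∈ᶠ 𝓑 × star B ≡ C)) ×
  (∀ B (i j : Fin n) → B ∈ᶠ 𝓑 → i ≢ j → transposeSet i j B ∈ᶠ 𝓑 →
     transposeSet i j (star B) ∈ᶠ 𝓑* × transposeSet i j (star B) ≡ star (transposeSet i j B)) ×
  (∀ B (i j : Fin n) → B ∈ᶠ 𝓑 → i ≢ j → transposeSet i j (star B) ∈ᶠ 𝓑* →
     transposeSet i j B ∈ᶠ 𝓑 × transposeSet i j (star B) ≡ star (transposeSet i j B))

σ : ∀ {n} → LinOrder n → LinOrder n → SetFamily n → SetFamily n →
    (Subset n → Subset n) → Fin n → Fin n → Subset n → Subset n
σ ω π 𝓑 𝓑* star a z B =
  if isBranchingImage ω π 𝓑 B ∨ isBranchingImage ω π 𝓑* (star B)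
  then transposeSet a z B else B

SwapOrder : ∀ {n} → LinOrder n → Fin n → Fin n → LinOrder n → Set
SwapOrder {n} ω a z π =
  (∀ (x y : Fin n) → ¬ ((x ≡ a × y ≡ z) ⊎ (x ≡ z × y ≡ a)) →
     (x <[ π ] y → x <[ ω ] y) × (x <[ ω ] y → x <[ π ] y)) ×
  z <[ π ] a

-- Swapping the ω-adjacent pair a <ω z changes φ only on branching almost-bases D; there the
-- two images are P = D + a and εP = D + z, both bases. For such a pivot P the transposition ε
-- maps φ_ω-preimages of P onto φ_π-preimages of εP, and those of εP onto those of P, as soon as
-- P satisfies one of two conditions: no y <ω a outside P replaces a, or z replaces no y <ω a in
-- P. (Otherwise a basis exchange between P and the transposed preimage produces an element
-- undercutting the ω-minimum that defines the preimage.) A branching almost-basis yields the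
-- first condition; since a linking preserves which transpositions carry a basis to another
-- basis, it yields one of the two conditions for the linked basis, so σ exchanges both counts.

module Submission where

open import Defs
open import Data.Nat using (ℕ; zero; suc; _≤_; _<?_)
import Data.Nat.Properties as ℕ
open import Data.Bool using (Bool; true; false; _∧_; _∨_; not; if_then_else_; T; T?)
open import Data.Bool.Properties
  using (∧-conicalˡ; ∧-conicalʳ; not-injective; ∧-zeroʳ; ∧-identityʳ; ∨-zeroʳ; ∨-identityʳ; not-¬; ¬-not; ⇔→≡; T-≡)
open import Data.Bool.ListAction using (any)
import Data.Bool as Bool
open import Data.Fin using (Fin; zero; suc)
import Data.Fin.Properties as Fin
open import Data.Fin.Subset using (Subset; ⁅_⁆; _─_; _-_; _∈_; _∉_)
open import Data.Fin.Permutation using (_⟨$⟩ˡ_; inverseˡ)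
import Data.Fin.Permutation.Components as PC
open import Data.List using (List; []; _∷_; map; filterᵇ; length; allFin)
open import Data.List.Membership.Propositional using (find; lose) renaming (_∈_ to _∈ₗ_)
open import Data.List.Membership.Propositional.Properties
  using (∈-filter⁺; ∈-filter⁻; ∈-allFin; ∈-map⁺; ∈-map⁻; ∈-++⁺ˡ; ∈-++⁺ʳ)
open import Data.List.Membership.Propositional.Properties.WithK using (unique∧set⇒bag)
open import Data.List.Relation.Binary.BagAndSetEquality using (∼bag⇒↭)
open import Data.List.Relation.Binary.Permutation.Propositional using (_↭_)
open import Data.List.Relation.Binary.Permutation.Propositional.Properties using (↭-length; filter-↭)
import Data.List.Relation.Unary.All as All
import Data.List.Relation.Unary.AllPairs as AllPairs
open import Data.List.Relation.Unary.Any using (here; there)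
open import Data.List.Relation.Unary.Any.Properties using (any⁺; any⁻)
open import Data.List.Relation.Unary.Unique.Propositional using (Unique)
import Data.List.Relation.Unary.Unique.Propositional.Properties as Unique
open import Data.Maybe using (Maybe; just; nothing)
open import Data.Maybe.Properties using (just-injective)
import Data.Maybe.Properties as Maybe
open import Data.Vec using ([]; _∷_; lookup)
import Data.Vec.Properties as Vec
open import Data.Product using (_×_; _,_; proj₁; proj₂; ∃-syntax; uncurry)
open import Data.Sum using (_⊎_; inj₁; inj₂; [_,_])
import Data.Sum as Sum
import Data.Product as Product
open import Data.Empty using (⊥; ⊥-elim)
open import Function using (id; _∘_; _⇔_; mk⇔; Equivalence)
open import Relation.Nullary using (¬_; Dec; does; yes; no)
open import Relation.Nullary.Decidable using (dec-true; dec-false)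
open import Relation.Binary.Definitions using (Tri; tri<; tri≈; tri>)
open import Relation.Binary.PropositionalEquality hiding ([_])

∧-true⁻ : ∀ {b c} → b ∧ c ≡ true → b ≡ true × c ≡ true
∧-true⁻ e = ∧-conicalˡ _ _ e , ∧-conicalʳ _ _ e

∧-true⁺ : ∀ {b c} → b ≡ true → c ≡ true → b ∧ c ≡ true
∧-true⁺ refl refl = refl

∨-true⁺ˡ : ∀ {b c} → b ≡ true → b ∨ c ≡ true
∨-true⁺ˡ refl = refl

∨-true⁺ʳ : ∀ {b c} → c ≡ true → b ∨ c ≡ true
∨-true⁺ʳ {b} refl = ∨-zeroʳ b

∨-true⁻ : ∀ {b c} → b ∨ c ≡ true → b ≡ true ⊎ c ≡ true
∨-true⁻ {true}  _ = inj₁ refl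
∨-true⁻ {false} e = inj₂ e

module _ {A : Set} (p : A → Bool) where

  filterᵇ⁺ : ∀ {x xs} → x ∈ₗ xs → p x ≡ true → x ∈ₗ filterᵇ p xs
  filterᵇ⁺ x∈ px = ∈-filter⁺ (T? ∘ p) x∈ (Equivalence.from T-≡ px)

  filterᵇ⁻ : ∀ {x} xs → x ∈ₗ filterᵇ p xs → p x ≡ true
  filterᵇ⁻ xs x∈ = Equivalence.to T-≡ (proj₂ (∈-filter⁻ (T? ∘ p) {xs = xs} x∈))

  any-true⁺ : ∀ {x xs} → x ∈ₗ xs → p x ≡ true → any p xs ≡ true
  any-true⁺ x∈ px = Equivalence.to T-≡ (any⁺ p (lose {P = T ∘ p} x∈ (Equivalence.from T-≡ px)))

  any-true⁻ : ∀ xs → any p xs ≡ true → ∃[ x ] (x ∈ₗ xs × p x ≡ true)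
  any-true⁻ xs e with find (any⁻ p xs (Equivalence.from T-≡ e))
  ... | x , x∈ , px = x , x∈ , Equivalence.to T-≡ px

  count : List A → ℕ
  count xs = length (filterᵇ p xs)

  count-↭ : ∀ {xs ys} → xs ↭ ys → count xs ≡ count ys
  count-↭ xs↭ys = ↭-length (filter-↭ (T? ∘ p) xs↭ys)

count-cong : ∀ {A : Set} {p q : A → Bool} → (∀ x → p x ≡ q x) → ∀ xs → count p xs ≡ count q xs
count-cong         p≗q []       = refl
count-cong {p = p} {q} p≗q (x ∷ xs) with p x | q x | p≗q x
... | true  | true  | _ = cong suc (count-cong p≗q xs)
... | false | false | _ = count-cong p≗q xs

count-map : ∀ {A : Set} (p : A → Bool) (f : A → A) xs → count p (map f xs) ≡ count (p ∘ f) xs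
count-map p f []       = refl
count-map p f (x ∷ xs) with p (f x)
... | true  = cong suc (count-map p f xs)
... | false = count-map p f xs

∈-allSubsets : ∀ n (S : Subset n) → S ∈ₗ allSubsets n
∈-allSubsets zero    []          = here refl
∈-allSubsets (suc n) (true ∷ S)  = ∈-++⁺ˡ (∈-map⁺ (true ∷_) (∈-allSubsets n S))
∈-allSubsets (suc n) (false ∷ S) = ∈-++⁺ʳ (map (true ∷_) (allSubsets n)) (∈-map⁺ (false ∷_) (∈-allSubsets n S))

allSubsets-unique : ∀ n → Unique (allSubsets n)
allSubsets-unique zero    = All.[] AllPairs.∷ AllPairs.[]
allSubsets-unique (suc n) = Unique.++⁺ (Unique.map⁺ ∷-injectiveʳ (allSubsets-unique n))
                                       (Unique.map⁺ ∷-injectiveʳ (allSubsets-unique n)) disjoint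
  where
  ∷-injectiveʳ : ∀ {b} {S T : Subset n} → b ∷ S ≡ b ∷ T → S ≡ T
  ∷-injectiveʳ refl = refl
  disjoint : ∀ {S} → S ∈ₗ map (true ∷_) (allSubsets n) × S ∈ₗ map (false ∷_) (allSubsets n) → ⊥
  disjoint (S∈₁ , S∈₂) with ∈-map⁻ (true ∷_) S∈₁ | ∈-map⁻ (false ∷_) S∈₂
  ... | _ , _ , refl | _ , _ , ()

map-involution-↭ : ∀ n (f : Subset n → Subset n) → (∀ S → f (f S) ≡ S) → map f (allSubsets n) ↭ allSubsets n
map-involution-↭ n f f∘f =
  ∼bag⇒↭ (unique∧set⇒bag (Unique.map⁺ f-injective (allSubsets-unique n)) (allSubsets-unique n)
    (λ {S} → mk⇔ (λ _ → ∈-allSubsets n S) (λ _ → S∈f[allSubsets] S)))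
  where
  S∈f[allSubsets] : ∀ S → S ∈ₗ map f (allSubsets n)
  S∈f[allSubsets] S = subst (_∈ₗ map f (allSubsets n)) (f∘f S) (∈-map⁺ f (∈-allSubsets n (f S)))

  f-injective : ∀ {S T} → f S ≡ f T → S ≡ T
  f-injective {S} {T} e = trans (sym (f∘f S)) (trans (cong f e) (f∘f T))

count-∘-involution : ∀ n (p : Subset n → Bool) (f : Subset n → Subset n) → (∀ S → f (f S) ≡ S) →
  count (p ∘ f) (allSubsets n) ≡ count p (allSubsets n)
count-∘-involution n p f f∘f = trans (sym (count-map p f (allSubsets n))) (count-↭ p (map-involution-↭ n f f∘f))

≟-same : ∀ {n} (x : Fin n) → does (x Fin.≟ x) ≡ true
≟-same x = dec-true (x Fin.≟ x) refl

≟-other : ∀ {n} {x y : Fin n} → x ≢ y → does (x Fin.≟ y) ≡ false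
≟-other x≢y = dec-false (_ Fin.≟ _) x≢y

subset-ext : ∀ {n} {S T : Subset n} → (∀ x → lookup S x ≡ lookup T x) → S ≡ T
subset-ext {S = S} {T} S≗T =
  trans (sym (Vec.tabulate∘lookup S)) (trans (Vec.tabulate-cong S≗T) (Vec.tabulate∘lookup T))

≢-at : ∀ {n} {S T : Subset n} x → lookup S x ≡ true → lookup T x ≡ false → S ≢ T
≢-at x Sx Tx refl = not-¬ Sx Tx

∈∧∉⇒≢ : ∀ {n} (S : Subset n) {x y} → lookup S x ≡ true → lookup S y ≡ false → x ≢ y
∈∧∉⇒≢ S Sx Sy refl = not-¬ Sx Sy

lookup-⁅⁆ : ∀ {n} (y x : Fin n) → lookup ⁅ y ⁆ x ≡ does (x Fin.≟ y)
lookup-⁅⁆ zero    zero    = refl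
lookup-⁅⁆ zero    (suc x) = Vec.lookup-replicate x false
lookup-⁅⁆ (suc y) zero    = refl
lookup-⁅⁆ (suc y) (suc x) = lookup-⁅⁆ y x

lookup-─ : ∀ {n} (S T : Subset n) x → lookup (S ─ T) x ≡ (lookup S x ∧ not (lookup T x))
lookup-─ (b ∷ S) (true  ∷ T) zero    = sym (∧-zeroʳ b)
lookup-─ (b ∷ S) (false ∷ T) zero    = sym (∧-identityʳ b)
lookup-─ (b ∷ S) (c     ∷ T) (suc x) = lookup-─ S T x

-- Sets built from a set variable by adding and deleting points: identities between them
-- are checked through `member`, by comparing a point with the finitely many points involved.
infixl 6 _⊕ₜ_ _-ₜ_

data Term (n : ℕ) : Set where
  var  : Term n
  _⊕ₜ_ : Term n → Fin n → Term n
  _-ₜ_ : Term n → Fin n → Term n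

module _ {n : ℕ} where

  ⟦_⟧ : Term n → Subset n → Subset n
  ⟦ var    ⟧ S = S
  ⟦ e ⊕ₜ y ⟧ S = ⟦ e ⟧ S ⊕ y
  ⟦ e -ₜ y ⟧ S = ⟦ e ⟧ S - y

  member : Term n → Subset n → Fin n → Bool
  member var      S x = lookup S x
  member (e ⊕ₜ y) S x = if does (x Fin.≟ y) then true  else member e S x
  member (e -ₜ y) S x = if does (x Fin.≟ y) then false else member e S x

  lookup-⟦⟧ : ∀ e S x → lookup (⟦ e ⟧ S) x ≡ member e S x
  lookup-⟦⟧ var      S x = refl
  lookup-⟦⟧ (e ⊕ₜ y) S x
    rewrite Vec.lookup-zipWith _∨_ x (⟦ e ⟧ S) ⁅ y ⁆ | lookup-⁅⁆ y x | lookup-⟦⟧ e S x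
    with does (x Fin.≟ y)
  ... | true  = ∨-zeroʳ _
  ... | false = ∨-identityʳ _
  lookup-⟦⟧ (e -ₜ y) S x
    rewrite lookup-─ (⟦ e ⟧ S) ⁅ y ⁆ x | lookup-⁅⁆ y x | lookup-⟦⟧ e S x
    with does (x Fin.≟ y)
  ... | true  = ∧-zeroʳ _
  ... | false = ∧-identityʳ _

  ⟦⟧-≡ : ∀ e₁ e₂ S → (∀ x → member e₁ S x ≡ member e₂ S x) → ⟦ e₁ ⟧ S ≡ ⟦ e₂ ⟧ S
  ⟦⟧-≡ e₁ e₂ S e₁≗e₂ = subset-ext λ x → trans (lookup-⟦⟧ e₁ S x) (trans (e₁≗e₂ x) (sym (lookup-⟦⟧ e₂ S x)))

  lookup-add-same : ∀ S y → lookup (S ⊕ y) y ≡ true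
  lookup-add-same S y = trans (lookup-⟦⟧ (var ⊕ₜ y) S y) (cong (if_then true else lookup S y) (≟-same y))

  lookup-add-other : ∀ S {y x} → x ≢ y → lookup (S ⊕ y) x ≡ lookup S x
  lookup-add-other S {y} {x} x≢y = trans (lookup-⟦⟧ (var ⊕ₜ y) S x) (cong (if_then true else lookup S x) (≟-other x≢y))

  lookup-del-same : ∀ S y → lookup (S - y) y ≡ false
  lookup-del-same S y = trans (lookup-⟦⟧ (var -ₜ y) S y) (cong (if_then false else lookup S y) (≟-same y))

  lookup-del-other : ∀ S {y x} → x ≢ y → lookup (S - y) x ≡ lookup S x
  lookup-del-other S {y} {x} x≢y = trans (lookup-⟦⟧ (var -ₜ y) S x) (cong (if_then false else lookup S x) (≟-other x≢y))

  add-del-cancel : ∀ S y → lookup S y ≡ false → (S ⊕ y) - y ≡ S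
  add-del-cancel S y Sy = ⟦⟧-≡ (var ⊕ₜ y -ₜ y) var S same
    where
    same : ∀ x → member (var ⊕ₜ y -ₜ y) S x ≡ lookup S x
    same x with x Fin.≟ y
    ... | yes refl = sym Sy
    ... | no  _    = refl

  ∈-add⁺ : ∀ S {v w : Fin n} → lookup S w ≡ true → lookup (S ⊕ v) w ≡ true
  ∈-add⁺ S {v} {w} w∈S = trans (Vec.lookup-zipWith _∨_ w S ⁅ v ⁆) (cong (_∨ lookup ⁅ v ⁆ w) w∈S)

  ∈-del⁻ : ∀ S {v w : Fin n} → lookup (S - v) w ≡ true → lookup S w ≡ true
  ∈-del⁻ S {v} {w} w∈S-v = ∧-conicalˡ _ _ (trans (sym (lookup-─ S ⁅ v ⁆ w)) w∈S-v)

transpose-left : ∀ {n} (i j : Fin n) → PC.transpose i j i ≡ j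
transpose-left i j rewrite ≟-same i = refl

transpose-right : ∀ {n} (i j : Fin n) → PC.transpose i j j ≡ i
transpose-right i j with j Fin.≟ i
... | yes j≡i = j≡i
... | no  _ rewrite ≟-same j = refl

transpose-other : ∀ {n} {i j k : Fin n} → k ≢ i → k ≢ j → PC.transpose i j k ≡ k
transpose-other k≢i k≢j rewrite ≟-other k≢i | ≟-other k≢j = refl

transpose-comm : ∀ {n} (i j k : Fin n) → PC.transpose j i k ≡ PC.transpose i j k
transpose-comm i j k = by-cases (k Fin.≟ i) (k Fin.≟ j)
  where
  by-cases : Dec (k ≡ i) → Dec (k ≡ j) → PC.transpose j i k ≡ PC.transpose i j k
  by-cases (yes refl) _          = trans (transpose-right j k) (sym (transpose-left k j))
  by-cases (no _)     (yes refl) = trans (transpose-left k i) (sym (transpose-right i k))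
  by-cases (no k≢i)   (no k≢j)   = trans (transpose-other k≢j k≢i) (sym (transpose-other k≢i k≢j))

module _ {n : ℕ} (i j : Fin n) where

  lookup-transposeSet : ∀ S x → lookup (transposeSet i j S) x ≡ lookup S (PC.transpose i j x)
  lookup-transposeSet S x = Vec.lookup∘tabulate _ x

  lookup-transposeSet-left : ∀ S → lookup (transposeSet i j S) i ≡ lookup S j
  lookup-transposeSet-left S = trans (lookup-transposeSet S i) (cong (lookup S) (transpose-left i j))

  lookup-transposeSet-right : ∀ S → lookup (transposeSet i j S) j ≡ lookup S i
  lookup-transposeSet-right S = trans (lookup-transposeSet S j) (cong (lookup S) (transpose-right i j))

  lookup-transposeSet-other : ∀ S {x} → x ≢ i → x ≢ j → lookup (transposeSet i j S) x ≡ lookup S x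
  lookup-transposeSet-other S x≢i x≢j = trans (lookup-transposeSet S _) (cong (lookup S) (transpose-other x≢i x≢j))

  transposeSet-comm : ∀ S → transposeSet j i S ≡ transposeSet i j S
  transposeSet-comm S = subset-ext λ x →
    trans (Vec.lookup∘tabulate _ x) (trans (cong (lookup S) (transpose-comm i j x)) (sym (lookup-transposeSet S x)))

  transposeSet-involutive : ∀ S → transposeSet i j (transposeSet i j S) ≡ S
  transposeSet-involutive S = subset-ext λ x → begin
    lookup (transposeSet i j (transposeSet i j S)) x   ≡⟨ lookup-transposeSet (transposeSet i j S) x ⟩
    lookup (transposeSet i j S) (PC.transpose i j x)   ≡⟨ lookup-transposeSet S _ ⟩
    lookup S (PC.transpose i j (PC.transpose i j x))   ≡⟨ cong (lookup S ∘ PC.transpose i j) (transpose-comm j i x) ⟩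
    lookup S (PC.transpose i j (PC.transpose j i x))   ≡⟨ cong (lookup S) (PC.transpose-inverse i j) ⟩
    lookup S x                                         ∎
    where open ≡-Reasoning

  transposeSet-fix : ∀ S → lookup S i ≡ lookup S j → transposeSet i j S ≡ S
  transposeSet-fix S Si≡Sj = subset-ext λ x → fixes (x Fin.≟ i) (x Fin.≟ j)
    where
    fixes : ∀ {x} → Dec (x ≡ i) → Dec (x ≡ j) → lookup (transposeSet i j S) x ≡ lookup S x
    fixes (yes refl) _          = trans (lookup-transposeSet-left S) (sym Si≡Sj)
    fixes (no _)     (yes refl) = trans (lookup-transposeSet-right S) Si≡Sj
    fixes (no x≢i)   (no x≢j)   = lookup-transposeSet-other S x≢i x≢j

  transposeSet-exchange : ∀ S → lookup S i ≡ true → lookup S j ≡ false → transposeSet i j S ≡ (S - i) ⊕ j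
  transposeSet-exchange S Si Sj = subset-ext λ x →
    trans (exchanges (x Fin.≟ j) (x Fin.≟ i)) (sym (lookup-⟦⟧ (var -ₜ i ⊕ₜ j) S x))
    where
    exchanges : ∀ {x} → Dec (x ≡ j) → Dec (x ≡ i) →
                lookup (transposeSet i j S) x ≡ member (var -ₜ i ⊕ₜ j) S x
    exchanges (yes refl) _          rewrite ≟-same j = trans (lookup-transposeSet-right S) Si
    exchanges {x} (no x≢j) (yes refl) rewrite ≟-other x≢j | ≟-same x = trans (lookup-transposeSet-left S) Sj
    exchanges {x} (no x≢j) (no x≢i) rewrite ≟-other x≢j | ≟-other x≢i = lookup-transposeSet-other S x≢i x≢j

-- The greedy map φ

rank-injective : ∀ {n} (ρ : LinOrder n) {x y} → rank ρ x ≡ rank ρ y → x ≡ y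
rank-injective ρ e = trans (sym (inverseˡ ρ)) (trans (cong (ρ ⟨$⟩ˡ_) (Fin.toℕ-injective e)) (inverseˡ ρ))

≤∧≢⇒<[] : ∀ {n} (ρ : LinOrder n) {x y} → rank ρ x ≤ rank ρ y → x ≢ y → x <[ ρ ] y
≤∧≢⇒<[] ρ x≤y x≢y = ℕ.≤∧≢⇒< x≤y (x≢y ∘ rank-injective ρ)

<[]⇒≢ : ∀ {n} (ρ : LinOrder n) {x y} → x <[ ρ ] y → x ≢ y
<[]⇒≢ ρ x<y refl = ℕ.<-irrefl refl x<y

module _ {n : ℕ} (ρ : LinOrder n) where

  minBy-nothing : ∀ xs → minBy ρ xs ≡ nothing → xs ≡ []
  minBy-nothing []       _ = refl
  minBy-nothing (x ∷ xs) e with minBy ρ xs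
  minBy-nothing (x ∷ xs) () | nothing
  minBy-nothing (x ∷ xs) e  | just y with rank ρ x <? rank ρ y
  minBy-nothing (x ∷ xs) () | just y | yes _
  minBy-nothing (x ∷ xs) () | just y | no _

  minBy-nonempty : ∀ {x} xs → x ∈ₗ xs → ∃[ m ] (minBy ρ xs ≡ just m)
  minBy-nonempty xs x∈ with minBy ρ xs in e
  ... | just m  = m , refl
  ... | nothing with refl ← minBy-nothing xs e with () ← x∈

  minBy-least : ∀ xs {m} → minBy ρ xs ≡ just m → m ∈ₗ xs × (∀ {y} → y ∈ₗ xs → rank ρ m ≤ rank ρ y)
  minBy-least (x ∷ xs) e with minBy ρ xs in e′
  minBy-least (x ∷ xs) refl | nothing with refl ← minBy-nothing xs e′ = here refl , λ { (here refl) → ℕ.≤-refl }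
  minBy-least (x ∷ xs) e    | just y with rank ρ x <? rank ρ y | minBy-least xs e′
  minBy-least (x ∷ xs) refl | just y | yes x<y | _ , y-least =
    here refl , λ { (here refl) → ℕ.≤-refl ; (there v∈) → ℕ.≤-trans (ℕ.<⇒≤ x<y) (y-least v∈) }
  minBy-least (x ∷ xs) refl | just y | no x≮y  | y∈ , y-least =
    there y∈ , λ { (here refl) → ℕ.≮⇒≥ x≮y ; (there v∈) → y-least v∈ }

  minBy-≡-just : ∀ xs {m} → m ∈ₗ xs → (∀ {y} → y ∈ₗ xs → rank ρ m ≤ rank ρ y) → minBy ρ xs ≡ just m
  minBy-≡-just xs m∈ m-least with minBy-nonempty xs m∈
  ... | m′ , e with minBy-least xs e
  ... | m′∈ , m′-least = trans e (cong just (rank-injective ρ (ℕ.≤-antisym (m′-least m∈) (m-least m′∈))))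

module _ {n : ℕ} where

  addable : SetFamily n → Subset n → Fin n → Bool
  addable 𝓒 D x = not (lookup D x) ∧ 𝓒 (D ⊕ x)

  ∈-U⁺ : ∀ 𝓒 D {y} → lookup D y ≡ false → (D ⊕ y) ∈ᶠ 𝓒 → y ∈ₗ U 𝓒 D
  ∈-U⁺ 𝓒 D {y} y∉D D+y∈𝓒 = filterᵇ⁺ (addable 𝓒 D) (∈-allFin y) (∧-true⁺ (cong not y∉D) D+y∈𝓒)

  ∈-U⁻ : ∀ 𝓒 D {y} → y ∈ₗ U 𝓒 D → lookup D y ≡ false × (D ⊕ y) ∈ᶠ 𝓒
  ∈-U⁻ 𝓒 D y∈ with ∧-true⁻ (filterᵇ⁻ (addable 𝓒 D) (allFin n) y∈)
  ... | y∉D , D+y∈𝓒 = not-injective y∉D , D+y∈𝓒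

  record LeastAddable (ρ : LinOrder n) (𝓒 : SetFamily n) (D : Subset n) (m : Fin n) : Set where
    field
      m∉D   : lookup D m ≡ false
      D+m∈𝓒 : (D ⊕ m) ∈ᶠ 𝓒
      least : ∀ {y} → lookup D y ≡ false → (D ⊕ y) ∈ᶠ 𝓒 → rank ρ m ≤ rank ρ y

  open LeastAddable public

  φ≡just⇒ : ∀ ρ 𝓒 D {C} → φ ρ 𝓒 D ≡ just C → ∃[ m ] (LeastAddable ρ 𝓒 D m × C ≡ D ⊕ m)
  φ≡just⇒ ρ 𝓒 D e with minBy ρ (U 𝓒 D) in min≡
  φ≡just⇒ ρ 𝓒 D refl | just m with minBy-least ρ (U 𝓒 D) min≡
  ... | m∈ , m-least = m , leastAddable , refl
    where
    leastAddable : LeastAddable ρ 𝓒 D m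
    leastAddable = record
      { m∉D = proj₁ (∈-U⁻ 𝓒 D m∈) ; D+m∈𝓒 = proj₂ (∈-U⁻ 𝓒 D m∈) ; least = λ y∉D D+y∈𝓒 → m-least (∈-U⁺ 𝓒 D y∉D D+y∈𝓒) }

  ⇒φ≡just : ∀ ρ 𝓒 D {m} → LeastAddable ρ 𝓒 D m → φ ρ 𝓒 D ≡ just (D ⊕ m)
  ⇒φ≡just ρ 𝓒 D la
    rewrite minBy-≡-just ρ (U 𝓒 D) (∈-U⁺ 𝓒 D (m∉D la) (D+m∈𝓒 la)) (λ y∈ → uncurry (least la) (∈-U⁻ 𝓒 D y∈)) = refl

  φ≡just⇒removal : ∀ ρ 𝓒 D {C} → φ ρ 𝓒 D ≡ just C →
    ∃[ m ] (D ≡ C - m × lookup C m ≡ true × LeastAddable ρ 𝓒 (C - m) m)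
  φ≡just⇒removal ρ 𝓒 D e with φ≡just⇒ ρ 𝓒 D e
  ... | m , la , refl = m , sym D⊕m-m≡D , lookup-add-same D m , subst (λ S → LeastAddable ρ 𝓒 S m) (sym D⊕m-m≡D) la
    where
    D⊕m-m≡D : (D ⊕ m) - m ≡ D
    D⊕m-m≡D = add-del-cancel D m (m∉D la)

  φ-defined : ∀ ρ 𝓒 D → isAlmostBasis 𝓒 D ≡ true → ∃[ C ] (φ ρ 𝓒 D ≡ just C)
  φ-defined ρ 𝓒 D isAB with any-true⁻ (addable 𝓒 D) (allFin n) isAB
  ... | y , _ , y-addable with minBy-nonempty ρ (U 𝓒 D) (filterᵇ⁺ (addable 𝓒 D) (∈-allFin y) y-addable)
  ... | m , min≡ rewrite min≡ = D ⊕ m , refl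

  φ≡just⇒isAlmostBasis : ∀ ρ 𝓒 D {C} → φ ρ 𝓒 D ≡ just C → isAlmostBasis 𝓒 D ≡ true
  φ≡just⇒isAlmostBasis ρ 𝓒 D e with φ≡just⇒ ρ 𝓒 D e
  ... | m , la , _ = any-true⁺ (addable 𝓒 D) (∈-allFin m) (∧-true⁺ (cong not (m∉D la)) (D+m∈𝓒 la))

  eqM-sound : ∀ {u v : Maybe (Subset n)} → eqM u v ≡ true → u ≡ v
  eqM-sound {u} {v} e with Maybe.≡-dec (Vec.≡-dec Bool._≟_) u v
  ... | yes u≡v = u≡v

  eqM-refl : ∀ (u : Maybe (Subset n)) → eqM u u ≡ true
  eqM-refl u with Maybe.≡-dec (Vec.≡-dec Bool._≟_) u u
  ... | yes _   = refl
  ... | no  u≢u = ⊥-elim (u≢u refl)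

  eqM-just : ∀ {u : Maybe (Subset n)} {B} → u ≡ just B → eqM u (just B) ≡ true
  eqM-just {B = B} refl = eqM-refl (just B)

  eqM-distinct : ∀ {u v : Maybe (Subset n)} {B₁ B₂} → not (eqM u v) ≡ true → u ≡ just B₁ → v ≡ just B₂ → B₁ ≢ B₂
  eqM-distinct u≠v refl refl refl = not-¬ (eqM-refl _) (not-injective u≠v)

  isPreimage : LinOrder n → SetFamily n → Subset n → Subset n → Bool
  isPreimage ρ 𝓒 B D = isAlmostBasis 𝓒 D ∧ eqM (φ ρ 𝓒 D) (just B)

  isPreimage-sound : ∀ ρ 𝓒 B D → isPreimage ρ 𝓒 B D ≡ true → φ ρ 𝓒 D ≡ just B
  isPreimage-sound ρ 𝓒 B D e = eqM-sound (proj₂ (∧-true⁻ e))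

  isPreimage-complete : ∀ ρ 𝓒 B D → φ ρ 𝓒 D ≡ just B → isPreimage ρ 𝓒 B D ≡ true
  isPreimage-complete ρ 𝓒 B D e =
    ∧-true⁺ (φ≡just⇒isAlmostBasis ρ 𝓒 D e) (eqM-just e)

  preimageCount-transport : ∀ {ρ ρ′ 𝓒 B B′} (f : Subset n → Subset n) → (∀ S → f (f S) ≡ S) →
    (∀ D → φ ρ 𝓒 D ≡ just B → φ ρ′ 𝓒 (f D) ≡ just B′) →
    (∀ D → φ ρ′ 𝓒 D ≡ just B′ → φ ρ 𝓒 (f D) ≡ just B) →
    preimageCount ρ 𝓒 B ≡ preimageCount ρ′ 𝓒 B′
  preimageCount-transport {ρ} {ρ′} {𝓒} {B} {B′} f f∘f to from =
    trans (count-cong same (allSubsets n)) (count-∘-involution n (isPreimage ρ′ 𝓒 B′) f f∘f)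
    where
    same : ∀ D → isPreimage ρ 𝓒 B D ≡ isPreimage ρ′ 𝓒 B′ (f D)
    same D = ⇔→≡ (mk⇔
      (λ p → isPreimage-complete ρ′ 𝓒 B′ (f D) (to D (isPreimage-sound ρ 𝓒 B D p)))
      (λ p → isPreimage-complete ρ 𝓒 B D
               (subst (λ S → φ ρ 𝓒 S ≡ just B) (f∘f D) (from (f D) (isPreimage-sound ρ′ 𝓒 B′ (f D) p)))))

module _ {n : ℕ} (S : Subset n) where

  restore : ∀ {u} v → lookup S u ≡ true → ((S - u) ⊕ v) ⊕ u ≡ S ⊕ v
  restore {u} v u∈S = ⟦⟧-≡ (var -ₜ u ⊕ₜ v ⊕ₜ u) (var ⊕ₜ v) S agree
    where
    agree : ∀ t → member (var -ₜ u ⊕ₜ v ⊕ₜ u) S t ≡ member (var ⊕ₜ v) S t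
    agree t with t Fin.≟ u | t Fin.≟ v
    ... | yes refl | yes refl = refl
    ... | yes refl | no _     = sym u∈S
    ... | no _     | yes refl = refl
    ... | no _     | no _     = refl

  readd : ∀ {x u} v → lookup S x ≡ true → x ≢ u → (((S - x) - u) ⊕ v) ⊕ x ≡ (S - u) ⊕ v
  readd {x} {u} v x∈S x≢u = ⟦⟧-≡ (var -ₜ x -ₜ u ⊕ₜ v ⊕ₜ x) (var -ₜ u ⊕ₜ v) S agree
    where
    agree : ∀ t → member (var -ₜ x -ₜ u ⊕ₜ v ⊕ₜ x) S t ≡ member (var -ₜ u ⊕ₜ v) S t
    agree t with t Fin.≟ x | t Fin.≟ v | t Fin.≟ u
    ... | yes refl | yes refl | _        = refl
    ... | yes refl | no _     | yes refl = ⊥-elim (x≢u refl)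
    ... | yes refl | no _     | no _     = sym x∈S
    ... | no _     | yes refl | _        = refl
    ... | no _     | no _     | yes refl = refl
    ... | no _     | no _     | no _     = refl

  replace-back : ∀ u {v y} → lookup S v ≡ false → y ≢ v → (((S - u) ⊕ v) - v) ⊕ y ≡ (S - u) ⊕ y
  replace-back u {v} {y} v∉S y≢v = ⟦⟧-≡ (var -ₜ u ⊕ₜ v -ₜ v ⊕ₜ y) (var -ₜ u ⊕ₜ y) S agree
    where
    agree : ∀ t → member (var -ₜ u ⊕ₜ v -ₜ v ⊕ₜ y) S t ≡ member (var -ₜ u ⊕ₜ y) S t
    agree t with t Fin.≟ y | t Fin.≟ v | t Fin.≟ u
    ... | yes refl | _        | _        = refl
    ... | no _     | yes refl | yes refl = refl
    ... | no _     | yes refl | no _     = sym v∉S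
    ... | no _     | no _     | _        = refl

  replace-through : ∀ {u} v {y} → lookup S u ≡ true → y ≢ u → y ≢ v →
                    (((S - u) ⊕ v) - y) ⊕ u ≡ (S - y) ⊕ v
  replace-through {u} v {y} u∈S y≢u y≢v = ⟦⟧-≡ (var -ₜ u ⊕ₜ v -ₜ y ⊕ₜ u) (var -ₜ y ⊕ₜ v) S agree
    where
    agree : ∀ t → member (var -ₜ u ⊕ₜ v -ₜ y ⊕ₜ u) S t ≡ member (var -ₜ y ⊕ₜ v) S t
    agree t with t Fin.≟ u | t Fin.≟ y | t Fin.≟ v
    ... | yes refl | yes refl | _        = ⊥-elim (y≢u refl)
    ... | yes refl | no _     | yes refl = refl
    ... | yes refl | no _     | no _     = sym u∈S
    ... | no _     | yes refl | yes refl = ⊥-elim (y≢v refl)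
    ... | no _     | yes refl | no _     = refl
    ... | no _     | no _     | yes refl = refl
    ... | no _     | no _     | no _     = refl

  undo : ∀ {x u v y} → lookup S u ≡ true → lookup S v ≡ false → x ≢ u → y ≢ v →
         (((((S - x) - u) ⊕ v) ⊕ y) - v) ⊕ u ≡ (S - x) ⊕ y
  undo {x} {u} {v} {y} u∈S v∉S x≢u y≢v = ⟦⟧-≡ (var -ₜ x -ₜ u ⊕ₜ v ⊕ₜ y -ₜ v ⊕ₜ u) (var -ₜ x ⊕ₜ y) S agree
    where
    agree : ∀ t → member (var -ₜ x -ₜ u ⊕ₜ v ⊕ₜ y -ₜ v ⊕ₜ u) S t ≡ member (var -ₜ x ⊕ₜ y) S t
    agree t with t Fin.≟ u | t Fin.≟ v | t Fin.≟ y | t Fin.≟ x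
    ... | yes refl | _        | yes refl | _        = refl
    ... | yes refl | _        | no _     | yes refl = ⊥-elim (x≢u refl)
    ... | yes refl | _        | no _     | no _     = sym u∈S
    ... | no _     | yes refl | yes refl | _        = ⊥-elim (y≢v refl)
    ... | no _     | yes refl | no _     | yes refl = refl
    ... | no _     | yes refl | no _     | no _     = sym v∉S
    ... | no _     | no _     | yes refl | _        = refl
    ... | no _     | no _     | no _     | _        = refl

  round-trip : ∀ {x u v y} → lookup S x ≡ true → lookup S v ≡ false → x ≢ u → y ≢ v →
               (((((S - x) - u) ⊕ v) ⊕ y) - v) ⊕ x ≡ (S - u) ⊕ y
  round-trip {x} {u} {v} {y} x∈S v∉S x≢u y≢v = ⟦⟧-≡ (var -ₜ x -ₜ u ⊕ₜ v ⊕ₜ y -ₜ v ⊕ₜ x) (var -ₜ u ⊕ₜ y) S agree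
    where
    agree : ∀ t → member (var -ₜ x -ₜ u ⊕ₜ v ⊕ₜ y -ₜ v ⊕ₜ x) S t ≡ member (var -ₜ u ⊕ₜ y) S t
    agree t with t Fin.≟ x | t Fin.≟ v | t Fin.≟ y | t Fin.≟ u
    ... | yes refl | _        | yes refl | _        = refl
    ... | yes refl | _        | no _     | yes refl = ⊥-elim (x≢u refl)
    ... | yes refl | _        | no _     | no _     = sym x∈S
    ... | no _     | yes refl | yes refl | _        = ⊥-elim (y≢v refl)
    ... | no _     | yes refl | no _     | yes refl = refl
    ... | no _     | yes refl | no _     | no _     = sym v∉S
    ... | no _     | no _     | yes refl | _        = refl
    ... | no _     | no _     | no _     | _        = refl

BasisExchange : ∀ {n} → SetFamily n → Set
BasisExchange {n} 𝓑 = ∀ (B₁ B₂ : Subset n) (x : Fin n) → B₁ ∈ᶠ 𝓑 → B₂ ∈ᶠ 𝓑 → x ∈ B₁ → x ∉ B₂ →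
  ∃[ y ] (y ∈ B₂ × y ∉ B₁ × ((B₁ - x) ⊕ y) ∈ᶠ 𝓑)

module _ {n : ℕ} {𝓑 : SetFamily n} (exch : BasisExchange 𝓑) where

  exchange-between : ∀ {B₁ B₂ x y₁ y₂} → B₁ ∈ᶠ 𝓑 → B₂ ∈ᶠ 𝓑 → lookup B₁ x ≡ true → lookup B₂ x ≡ false →
    (∀ {w} → lookup B₂ w ≡ true → lookup B₁ w ≡ false → w ≡ y₁ ⊎ w ≡ y₂) →
    ((B₁ - x) ⊕ y₁) ∈ᶠ 𝓑 ⊎ ((B₁ - x) ⊕ y₂) ∈ᶠ 𝓑
  exchange-between {B₁} {B₂} {x} B₁∈𝓑 B₂∈𝓑 x∈B₁ x∉B₂ B₂∖B₁⊆
    with exch B₁ B₂ x B₁∈𝓑 B₂∈𝓑 (Vec.lookup⇒[]= _ _ x∈B₁) (λ x∈ → not-¬ (Vec.[]=⇒lookup x∈) x∉B₂)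
  ... | w , w∈B₂ , w∉B₁ , B∈𝓑 with B₂∖B₁⊆ (Vec.[]=⇒lookup w∈B₂) (¬-not (w∉B₁ ∘ Vec.lookup⇒[]= _ _))
  ... | inj₁ refl = inj₁ B∈𝓑
  ... | inj₂ refl = inj₂ B∈𝓑

  -- Q = S - x - u + v + y, so exchanging x out of S, or v out of Q, leaves two candidates each.
  module DoubleSwap {S x u v y} (S∈𝓑 : S ∈ᶠ 𝓑) (Q∈𝓑 : (((((S - x) - u) ⊕ v) ⊕ y) ∈ᶠ 𝓑))
    (x∈S : lookup S x ≡ true) (u∈S : lookup S u ≡ true) (v∉S : lookup S v ≡ false) (y∉S : lookup S y ≡ false)
    (x≢u : x ≢ u) (y≢v : y ≢ v) where

    private
      Q : Subset n
      Q = (((S - x) - u) ⊕ v) ⊕ y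

      x≢y : x ≢ y
      x≢y = ∈∧∉⇒≢ S x∈S y∉S

      Q∖S : ∀ {w} → lookup Q w ≡ true → lookup S w ≡ false → w ≡ y ⊎ w ≡ v
      Q∖S {w} w∈Q w∉S with w Fin.≟ y | w Fin.≟ v
      ... | yes w≡y | _       = inj₁ w≡y
      ... | no _    | yes w≡v = inj₂ w≡v
      ... | no w≢y  | no w≢v  = ⊥-elim (not-¬ (∈-del⁻ S (∈-del⁻ (S - x) w∈S-x-u)) w∉S)
        where
        w∈S-x-u : lookup ((S - x) - u) w ≡ true
        w∈S-x-u = trans (sym (trans (lookup-add-other (((S - x) - u) ⊕ v) w≢y)
                                    (lookup-add-other ((S - x) - u) w≢v))) w∈Q

      S∖Q : ∀ {w} → lookup S w ≡ true → lookup Q w ≡ false → w ≡ u ⊎ w ≡ x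
      S∖Q {w} w∈S w∉Q with w Fin.≟ u | w Fin.≟ x
      ... | yes w≡u | _       = inj₁ w≡u
      ... | no _    | yes w≡x = inj₂ w≡x
      ... | no w≢u  | no w≢x  = ⊥-elim (not-¬ (∈-add⁺ (((S - x) - u) ⊕ v) (∈-add⁺ ((S - x) - u) w∈S-x-u)) w∉Q)
        where
        w∈S-x-u : lookup ((S - x) - u) w ≡ true
        w∈S-x-u = trans (lookup-del-other (S - x) w≢u) (trans (lookup-del-other S w≢x) w∈S)

      x∉Q : lookup Q x ≡ false
      x∉Q = trans (lookup-add-other (((S - x) - u) ⊕ v) x≢y) (trans (lookup-add-other ((S - x) - u) (∈∧∉⇒≢ S x∈S v∉S))
              (trans (lookup-del-other (S - x) x≢u) (lookup-del-same S x)))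

      v∈Q : lookup Q v ≡ true
      v∈Q = trans (lookup-add-other (((S - x) - u) ⊕ v) (≢-sym y≢v)) (lookup-add-same ((S - x) - u) v)

    exchange-x : ((S - x) ⊕ y) ∈ᶠ 𝓑 ⊎ ((S - x) ⊕ v) ∈ᶠ 𝓑
    exchange-x = exchange-between S∈𝓑 Q∈𝓑 x∈S x∉Q Q∖S

    exchange-v : ((S - x) ⊕ y) ∈ᶠ 𝓑 ⊎ ((S - u) ⊕ y) ∈ᶠ 𝓑
    exchange-v with exchange-between Q∈𝓑 S∈𝓑 v∈Q v∉S S∖Q
    ... | inj₁ Q′∈𝓑 = inj₁ (subst (_∈ᶠ 𝓑) (undo S u∈S v∉S x≢u y≢v) Q′∈𝓑)
    ... | inj₂ Q′∈𝓑 = inj₂ (subst (_∈ᶠ 𝓑) (round-trip S x∈S v∉S x≢u y≢v) Q′∈𝓑)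

-- Adjacent swaps and pivots

record AdjacentSwap {n} (ω π : LinOrder n) (a z : Fin n) : Set where
  field
    a≢z      : a ≢ z
    a<z      : a <[ ω ] z
    adjacent : ∀ {y} → a <[ ω ] y → y ≢ z → z <[ ω ] y
    z<a      : z <[ π ] a
    agree    : ∀ x y → ¬ ((x ≡ a × y ≡ z) ⊎ (x ≡ z × y ≡ a)) →
               (x <[ π ] y → x <[ ω ] y) × (x <[ ω ] y → x <[ π ] y)

  ω⇒π : ∀ {x y} → x ≢ a → x ≢ z → x <[ ω ] y → x <[ π ] y
  ω⇒π x≢a x≢z = proj₂ (agree _ _ [ x≢a ∘ proj₁ , x≢z ∘ proj₁ ])

  π⇒ω : ∀ {x y} → x ≢ a → x ≢ z → x <[ π ] y → x <[ ω ] y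
  π⇒ω x≢a x≢z = proj₁ (agree _ _ [ x≢a ∘ proj₁ , x≢z ∘ proj₁ ])

  z-ω⇒π : ∀ {y} → y ≢ a → z <[ ω ] y → z <[ π ] y
  z-ω⇒π y≢a = proj₂ (agree _ _ [ a≢z ∘ sym ∘ proj₁ , y≢a ∘ proj₂ ])

  z-π⇒ω : ∀ {y} → y ≢ a → z <[ π ] y → z <[ ω ] y
  z-π⇒ω y≢a = proj₁ (agree _ _ [ a≢z ∘ sym ∘ proj₁ , y≢a ∘ proj₂ ])

  a-ω⇒π : ∀ {y} → y ≢ z → a <[ ω ] y → a <[ π ] y
  a-ω⇒π y≢z = proj₂ (agree _ _ [ y≢z ∘ proj₂ , a≢z ∘ proj₁ ])

  below-z⇒below-a : ∀ {x} → x ≢ a → x ≢ z → x <[ ω ] z → x <[ ω ] a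
  below-z⇒below-a {x} x≢a x≢z x<z with ℕ.<-cmp (rank ω x) (rank ω a)
  ... | tri< x<a _ _ = x<a
  ... | tri≈ _ x≡a _ = ⊥-elim (x≢a (rank-injective ω x≡a))
  ... | tri> _ _ a<x = ⊥-elim (ℕ.<-asym x<z (adjacent a<x x≢z))

  below-a⇒≢ : ∀ {y} → y <[ ω ] a → y ≢ a × y ≢ z
  below-a⇒≢ y<a = <[]⇒≢ ω y<a , λ { refl → ℕ.<-asym y<a a<z }

  reversed⇒a,z : ∀ {x y} → x <[ ω ] y → y <[ π ] x → x ≡ a × y ≡ z
  reversed⇒a,z {x} {y} x<y y<x with y Fin.≟ z | x Fin.≟ a
  ... | yes y≡z | yes x≡a = x≡a , y≡z
  ... | no y≢z  | _       = ⊥-elim (ℕ.<-asym x<y (proj₁ (agree y x [ not-z<a , y≢z ∘ proj₁ ]) y<x))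
    where
    not-z<a : ¬ (y ≡ a × x ≡ z)
    not-z<a (refl , refl) = ℕ.<-asym x<y a<z
  ... | yes _   | no x≢a  = ⊥-elim (ℕ.<-asym x<y (proj₁ (agree y x [ not-z<a , x≢a ∘ proj₂ ]) y<x))
    where
    not-z<a : ¬ (y ≡ a × x ≡ z)
    not-z<a (refl , refl) = ℕ.<-asym x<y a<z

  π-below-z : ∀ {y} → y <[ π ] z → y ≢ a × y ≢ z × y <[ ω ] a
  π-below-z {y} y<z = y≢a , y≢z , below-z⇒below-a y≢a y≢z (π⇒ω y≢a y≢z y<z)
    where
    y≢a : y ≢ a
    y≢a refl = ℕ.<-asym y<z z<a
    y≢z : y ≢ z
    y≢z = <[]⇒≢ π y<z

  flip : AdjacentSwap π ω z a
  flip = record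
    { a≢z      = ≢-sym a≢z
    ; a<z      = z<a
    ; adjacent = λ z<y y≢a → a-ω⇒π (≢-sym (<[]⇒≢ π z<y)) (ℕ.<-trans a<z (z-π⇒ω y≢a z<y))
    ; z<a      = a<z
    ; agree    = λ x y exceptional → Product.swap (agree x y (exceptional ∘ Sum.swap))
    }

adjacentSwap : ∀ {n} {ω π : LinOrder n} {a z} →
  a ≢ z → rank ω z ≡ suc (rank ω a) → SwapOrder ω a z π → AdjacentSwap ω π a z
adjacentSwap {ω = ω} a≢z z≡1+a (agree , z<a) = record
  { a≢z      = a≢z
  ; a<z      = ℕ.≤-reflexive (sym z≡1+a)
  ; adjacent = λ a<y y≢z → ≤∧≢⇒<[] ω (subst (_≤ _) (sym z≡1+a) a<y) (≢-sym y≢z)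
  ; z<a      = z<a
  ; agree    = agree
  }

module _ {n : ℕ} (𝓒 : SetFamily n) (ρ : LinOrder n) (a : Fin n) where

  NoLowerReplacementOfA : Subset n → Set
  NoLowerReplacementOfA P = ∀ {y} → y <[ ρ ] a → lookup P y ≡ false → ¬ (((P - a) ⊕ y) ∈ᶠ 𝓒)

  module _ (z : Fin n) where

    NoReplacementOfLowerByZ : Subset n → Set
    NoReplacementOfLowerByZ P = ∀ {y} → y <[ ρ ] a → lookup P y ≡ true → ¬ (((P - y) ⊕ z) ∈ᶠ 𝓒)

    Admissible : Subset n → Set
    Admissible P = NoLowerReplacementOfA P ⊎ NoReplacementOfLowerByZ P

module _ {n : ℕ} (𝓒 : SetFamily n) where

  record Pivot (a z : Fin n) (P : Subset n) : Set where
    field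
      a∈P  : lookup P a ≡ true
      z∉P  : lookup P z ≡ false
      P∈𝓒  : P ∈ᶠ 𝓒
      εP∈𝓒 : transposeSet a z P ∈ᶠ 𝓒

-- Preimages of a pivot

module PivotPreimages {n} {𝓒 : SetFamily n} (exch : BasisExchange 𝓒) {ω π : LinOrder n} {a z : Fin n}
  (sw : AdjacentSwap ω π a z) {P : Subset n} (pivot : Pivot 𝓒 a z P) (adm : Admissible 𝓒 ω a z P) where

  open AdjacentSwap sw
  open Pivot pivot

  private
    ε : Subset n → Subset n
    ε = transposeSet a z

    P′ : Subset n
    P′ = (P - a) ⊕ z

    εP≡P′ : ε P ≡ P′
    εP≡P′ = transposeSet-exchange a z P a∈P z∉P

    P′∈𝓒 : P′ ∈ᶠ 𝓒
    P′∈𝓒 = subst (_∈ᶠ 𝓒) εP≡P′ εP∈𝓒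

    a∉P′ : lookup P′ a ≡ false
    a∉P′ = trans (lookup-add-other (P - a) a≢z) (lookup-del-same P a)

    z∈P′ : lookup P′ z ≡ true
    z∈P′ = lookup-add-same (P - a) z

    z∉P-a : lookup (P - a) z ≡ false
    z∉P-a = trans (lookup-del-other P (≢-sym a≢z)) z∉P

    P′-z⊕a≡P : (P′ - z) ⊕ a ≡ P
    P′-z⊕a≡P = begin
      (P′ - z) ⊕ a        ≡⟨ sym (transposeSet-exchange z a P′ z∈P′ a∉P′) ⟩
      transposeSet z a P′ ≡⟨ transposeSet-comm a z P′ ⟩
      ε P′                ≡⟨ cong ε (sym εP≡P′) ⟩
      ε (ε P)             ≡⟨ transposeSet-involutive a z P ⟩
      P                   ∎
      where open ≡-Reasoning

  φπ[P-a] : LeastAddable ω 𝓒 (P - a) a → φ π 𝓒 (ε (P - a)) ≡ just (ε P)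
  φπ[P-a] la = subst₂ (λ S T → φ π 𝓒 S ≡ just T) (sym ε[P-a]≡P-a) (sym εP≡P′) (⇒φ≡just π 𝓒 (P - a) z-least)
    where
    ε[P-a]≡P-a : ε (P - a) ≡ P - a
    ε[P-a]≡P-a = transposeSet-fix a z (P - a) (trans (lookup-del-same P a) (sym z∉P-a))

    z-below : ∀ {y} → lookup (P - a) y ≡ false → ((P - a) ⊕ y) ∈ᶠ 𝓒 → rank π z ≤ rank π y
    z-below {y} y∉P-a P-a+y∈𝓒 with y Fin.≟ z | y Fin.≟ a
    ... | yes refl | _        = ℕ.≤-refl
    ... | no _     | yes refl = ℕ.<⇒≤ z<a
    ... | no y≢z   | no y≢a   = ℕ.<⇒≤ (z-ω⇒π y≢a (adjacent a<y y≢z))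
      where
      a<y : a <[ ω ] y
      a<y = ≤∧≢⇒<[] ω (least la y∉P-a P-a+y∈𝓒) (≢-sym y≢a)

    z-least : LeastAddable π 𝓒 (P - a) z
    z-least = record { m∉D = z∉P-a ; D+m∈𝓒 = P′∈𝓒 ; least = z-below }

  -- φ_ω(P - x) = P with x ≢ a: then x is also π-least addable to ε(P - x) = P - x - a + z.
  module MinimumOtherThanA {x} (x≢a : x ≢ a) (x∈P : lookup P x ≡ true) (la : LeastAddable ω 𝓒 (P - x) x) where

    private
      x≢z : x ≢ z
      x≢z = ∈∧∉⇒≢ P x∈P z∉P

      D E : Subset n
      D = P - x
      E = (D - a) ⊕ z

      a∈D : lookup D a ≡ true
      a∈D = trans (lookup-del-other P (≢-sym x≢a)) a∈P

      z∉D : lookup D z ≡ false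
      z∉D = trans (lookup-del-other P (≢-sym x≢z)) z∉P

      -- Exchanging with Q = E + y makes y addable to D, against the minimality of x, or else
      -- contradicts the position of x relative to a or the admissibility of P.
      lower-impossible : ∀ {y} → y ≢ z → lookup P y ≡ false → (E ⊕ y) ∈ᶠ 𝓒 → ¬ (y <[ ω ] x)
      lower-impossible {y} y≢z y∉P Q∈𝓒 y<x = by-position (ℕ.<-cmp (rank ω a) (rank ω x)) adm
        where
        open DoubleSwap exch P∈𝓒 Q∈𝓒 x∈P a∈P z∉P y∉P x≢a y≢z

        D⊕y∉𝓒 : ¬ ((D ⊕ y) ∈ᶠ 𝓒)
        D⊕y∉𝓒 = ℕ.<⇒≱ y<x ∘ least la (trans (lookup-del-other P (<[]⇒≢ ω y<x)) y∉P)

        by-position : Tri (a <[ ω ] x) (rank ω a ≡ rank ω x) (x <[ ω ] a) → Admissible 𝓒 ω a z P → ⊥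
        by-position (tri< a<x _ _) _          = [ D⊕y∉𝓒 , ℕ.<⇒≱ (adjacent a<x x≢z) ∘ least la z∉D ] exchange-x
        by-position (tri≈ _ a≡x _) _          = x≢a (sym (rank-injective ω a≡x))
        by-position (tri> _ _ x<a) (inj₂ noZ) = [ D⊕y∉𝓒 , noZ x<a x∈P ] exchange-x
        by-position (tri> _ _ x<a) (inj₁ noA) = [ D⊕y∉𝓒 , noA (ℕ.<-trans y<x x<a) y∉P ] exchange-v

      x-least : ∀ {y} → lookup E y ≡ false → (E ⊕ y) ∈ᶠ 𝓒 → rank π x ≤ rank π y
      x-least {y} y∉E E⊕y∈𝓒 with y Fin.≟ x | y Fin.≟ z | y Fin.≟ a
      ... | yes refl | _        | _        = ℕ.≤-refl
      ... | no _     | yes refl | _        = ⊥-elim (not-¬ (lookup-add-same (D - a) z) y∉E)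
      ... | no _     | no _     | yes refl = ℕ.<⇒≤ (ω⇒π x≢a x≢z (below-z⇒below-a x≢a x≢z x<z))
        where
        x<z : x <[ ω ] z
        x<z = ≤∧≢⇒<[] ω (least la z∉D (subst (_∈ᶠ 𝓒) (restore D z a∈D) E⊕y∈𝓒)) x≢z
      ... | no y≢x   | no y≢z   | no y≢a with ℕ.<-cmp (rank ω x) (rank ω y)
      ...   | tri< x<y _ _ = ℕ.<⇒≤ (ω⇒π x≢a x≢z x<y)
      ...   | tri≈ _ x≡y _ = ⊥-elim (y≢x (sym (rank-injective ω x≡y)))
      ...   | tri> _ _ y<x = ⊥-elim (lower-impossible y≢z y∉P E⊕y∈𝓒 y<x)
        where
        y∉P : lookup P y ≡ false
        y∉P = trans (sym (trans (lookup-add-other (D - a) y≢z)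
                                (trans (lookup-del-other D y≢a) (lookup-del-other P y≢x)))) y∉E

      E⊕x≡P′ : E ⊕ x ≡ P′
      E⊕x≡P′ = readd P z x∈P x≢a

      x-leastAddable : LeastAddable π 𝓒 E x
      x-leastAddable = record
        { m∉D   = trans (lookup-add-other (D - a) x≢z) (trans (lookup-del-other D x≢a) (lookup-del-same P x))
        ; D+m∈𝓒 = subst (_∈ᶠ 𝓒) (sym E⊕x≡P′) P′∈𝓒
        ; least = x-least
        }

    φπ-εD : φ π 𝓒 (ε (P - x)) ≡ just (ε P)
    φπ-εD = subst₂ (λ S T → φ π 𝓒 S ≡ just T) (sym εD≡E) (trans E⊕x≡P′ (sym εP≡P′)) (⇒φ≡just π 𝓒 E x-leastAddable)
      where
      εD≡E : ε D ≡ E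
      εD≡E = transposeSet-exchange a z D a∈D z∉D

  -- φ_ω(P′ - x) = P′ = ε P with x ∉ {a, z}: then x is π-least addable to ε(P′ - x) = P′ - x - z + a.
  module MinimumOtherThanAZ {x} (x≢a : x ≢ a) (x≢z : x ≢ z) (x∈P′ : lookup P′ x ≡ true)
    (la : LeastAddable ω 𝓒 (P′ - x) x) where

    private
      D F : Subset n
      D = P′ - x
      F = (D - z) ⊕ a

      x∈P : lookup P x ≡ true
      x∈P = trans (sym (trans (lookup-add-other (P - a) x≢z) (lookup-del-other P x≢a))) x∈P′

      z∈D : lookup D z ≡ true
      z∈D = trans (lookup-del-other P′ (≢-sym x≢z)) z∈P′

      a∉D : lookup D a ≡ false
      a∉D = trans (lookup-del-other P′ (≢-sym x≢a)) a∉P′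

      lower-impossible : ∀ {y} → y ≢ z → y ≢ a → lookup P′ y ≡ false → (F ⊕ y) ∈ᶠ 𝓒 → ¬ (y <[ ω ] x)
      lower-impossible {y} y≢z y≢a y∉P′ Q∈𝓒 y<x = by-position (ℕ.<-cmp (rank ω a) (rank ω x)) adm
        where
        open DoubleSwap exch P′∈𝓒 Q∈𝓒 x∈P′ z∈P′ a∉P′ y∉P′ x≢z y≢a

        D⊕y∉𝓒 : ¬ ((D ⊕ y) ∈ᶠ 𝓒)
        D⊕y∉𝓒 = ℕ.<⇒≱ y<x ∘ least la (trans (lookup-del-other P′ (<[]⇒≢ ω y<x)) y∉P′)

        y∉P : lookup P y ≡ false
        y∉P = trans (sym (trans (lookup-add-other (P - a) y≢z) (lookup-del-other P y≢a))) y∉P′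

        by-position : Tri (a <[ ω ] x) (rank ω a ≡ rank ω x) (x <[ ω ] a) → Admissible 𝓒 ω a z P → ⊥
        by-position (tri< a<x _ _) _          = [ D⊕y∉𝓒 , ℕ.<⇒≱ a<x ∘ least la a∉D ] exchange-x
        by-position (tri≈ _ a≡x _) _          = x≢a (sym (rank-injective ω a≡x))
        by-position (tri> _ _ x<a) (inj₂ noZ) =
          [ D⊕y∉𝓒 , noZ x<a x∈P ∘ subst (_∈ᶠ 𝓒) (replace-through P z a∈P x≢a x≢z) ] exchange-x
        by-position (tri> _ _ x<a) (inj₁ noA) =
          [ D⊕y∉𝓒 , noA (ℕ.<-trans y<x x<a) y∉P ∘ subst (_∈ᶠ 𝓒) (replace-back P a z∉P y≢z) ] exchange-v

      x-least : ∀ {y} → lookup F y ≡ false → (F ⊕ y) ∈ᶠ 𝓒 → rank π x ≤ rank π y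
      x-least {y} y∉F F⊕y∈𝓒 with y Fin.≟ x | y Fin.≟ a | y Fin.≟ z
      ... | yes refl | _        | _        = ℕ.≤-refl
      ... | no _     | yes refl | _        = ⊥-elim (not-¬ (lookup-add-same (D - z) a) y∉F)
      ... | no _     | no _     | yes refl = ℕ.<⇒≤ (ω⇒π x≢a x≢z (ℕ.<-trans x<a a<z))
        where
        x<a : x <[ ω ] a
        x<a = ≤∧≢⇒<[] ω (least la a∉D (subst (_∈ᶠ 𝓒) (restore D a z∈D) F⊕y∈𝓒)) x≢a
      ... | no y≢x   | no y≢a   | no y≢z with ℕ.<-cmp (rank ω x) (rank ω y)
      ...   | tri< x<y _ _ = ℕ.<⇒≤ (ω⇒π x≢a x≢z x<y)
      ...   | tri≈ _ x≡y _ = ⊥-elim (y≢x (sym (rank-injective ω x≡y)))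
      ...   | tri> _ _ y<x = ⊥-elim (lower-impossible y≢z y≢a y∉P′ F⊕y∈𝓒 y<x)
        where
        y∉P′ : lookup P′ y ≡ false
        y∉P′ = trans (sym (trans (lookup-add-other (D - z) y≢a)
                                 (trans (lookup-del-other D y≢z) (lookup-del-other P′ y≢x)))) y∉F

      F⊕x≡P : F ⊕ x ≡ P
      F⊕x≡P = trans (readd P′ a x∈P′ x≢z) P′-z⊕a≡P

      x-leastAddable : LeastAddable π 𝓒 F x
      x-leastAddable = record
        { m∉D   = trans (lookup-add-other (D - z) x≢a) (trans (lookup-del-other D x≢z) (lookup-del-same P′ x))
        ; D+m∈𝓒 = subst (_∈ᶠ 𝓒) (sym F⊕x≡P) P∈𝓒
        ; least = x-least
        }

    φπ-εD : φ π 𝓒 (ε (P′ - x)) ≡ just P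
    φπ-εD = subst₂ (λ S T → φ π 𝓒 S ≡ just T) (sym εD≡F) F⊕x≡P (⇒φ≡just π 𝓒 F x-leastAddable)
      where
      εD≡F : ε D ≡ F
      εD≡F = trans (sym (transposeSet-comm a z D)) (transposeSet-exchange z a D z∈D a∉D)

  ε-maps-ωpreimages-of-P : ∀ D → φ ω 𝓒 D ≡ just P → φ π 𝓒 (ε D) ≡ just (ε P)
  ε-maps-ωpreimages-of-P D φD≡P with φ≡just⇒removal ω 𝓒 D φD≡P
  ... | m , refl , m∈P , la with m Fin.≟ a
  ... | yes refl = φπ[P-a] la
  ... | no m≢a   = MinimumOtherThanA.φπ-εD m≢a m∈P la

  ε-maps-ωpreimages-of-εP : ∀ D → φ ω 𝓒 D ≡ just (ε P) → φ π 𝓒 (ε D) ≡ just P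
  ε-maps-ωpreimages-of-εP D φD≡εP with φ≡just⇒removal ω 𝓒 D (trans φD≡εP (cong just εP≡P′))
  ... | m , refl , m∈P′ , la with m Fin.≟ z | m Fin.≟ a
  ... | yes refl | _        = ⊥-elim (ℕ.<⇒≱ a<z (least la a∉P′-z (subst (_∈ᶠ 𝓒) (sym P′-z⊕a≡P) P∈𝓒)))
    where
    a∉P′-z : lookup (P′ - z) a ≡ false
    a∉P′-z = trans (lookup-del-other P′ a≢z) a∉P′
  ... | no _     | yes refl = ⊥-elim (not-¬ m∈P′ a∉P′)
  ... | no m≢z   | no m≢a   = MinimumOtherThanAZ.φπ-εD m≢a m≢z m∈P′ la

-- Transpositions and linkings

module _ {n : ℕ} where

  Moves : SetFamily n → Subset n → Fin n → Fin n → Set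
  Moves 𝓒 X i j = transposeSet i j X ∈ᶠ 𝓒 × transposeSet i j X ≢ X

  record SameMoves (𝓒₁ : SetFamily n) (X₁ : Subset n) (𝓒₂ : SetFamily n) (X₂ : Subset n) : Set where
    constructor mkSameMoves
    field
      moves⇔ : ∀ {i j} → i ≢ j → Moves 𝓒₁ X₁ i j ⇔ Moves 𝓒₂ X₂ i j

  open SameMoves public

  SameMoves-sym : ∀ {𝓒₁ X₁ 𝓒₂ X₂} → SameMoves 𝓒₁ X₁ 𝓒₂ X₂ → SameMoves 𝓒₂ X₂ 𝓒₁ X₁
  SameMoves-sym same = mkSameMoves λ i≢j → mk⇔ (Equivalence.from (moves⇔ same i≢j)) (Equivalence.to (moves⇔ same i≢j))

  linking-sameMoves : ∀ 𝓑 𝓑* star → IsLinking 𝓑 𝓑* star → ∀ {B} → B ∈ᶠ 𝓑 → SameMoves 𝓑 B 𝓑* (star B)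
  linking-sameMoves 𝓑 𝓑* star (_ , injective , _ , L1 , L2) {B} B∈𝓑 =
    mkSameMoves λ i≢j → mk⇔ (forward i≢j) (backward i≢j)
    where
    forward : ∀ {i j} → i ≢ j → Moves 𝓑 B i j → Moves 𝓑* (star B) i j
    forward {i} {j} i≢j (τB∈𝓑 , τB≢B) with L1 B i j B∈𝓑 i≢j τB∈𝓑
    ... | τB*∈𝓑* , τB*≡ = τB*∈𝓑* , λ τB*≡B* → τB≢B (injective _ _ τB∈𝓑 B∈𝓑 (trans (sym τB*≡) τB*≡B*))

    backward : ∀ {i j} → i ≢ j → Moves 𝓑* (star B) i j → Moves 𝓑 B i j
    backward {i} {j} i≢j (τB*∈𝓑* , τB*≢B*) with L2 B i j B∈𝓑 i≢j τB*∈𝓑*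
    ... | τB∈𝓑 , τB*≡ = τB∈𝓑 , λ τB≡B → τB*≢B* (trans τB*≡ (cong star τB≡B))

module _ {n : ℕ} {ω π : LinOrder n} {a z : Fin n} (sw : AdjacentSwap ω π a z) where

  open AdjacentSwap sw

  private
    ε : Subset n → Subset n
    ε = transposeSet a z

    εε : ∀ S → ε (ε S) ≡ S
    εε = transposeSet-involutive a z

    τza≡ε : ∀ S → transposeSet z a S ≡ ε S
    τza≡ε = transposeSet-comm a z

  InOrbit : Subset n → Subset n → Set
  InOrbit P X = X ≡ P ⊎ X ≡ ε P

  InOrbit-ε : ∀ {P X} → InOrbit P X → InOrbit P (ε X)
  InOrbit-ε (inj₁ refl) = inj₂ refl
  InOrbit-ε {P} (inj₂ refl) = inj₁ (εε P)

  module _ {𝓒 : SetFamily n} where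

    Pivot-flip : ∀ {P} → Pivot 𝓒 a z P → Pivot 𝓒 z a (ε P)
    Pivot-flip {P} pivot = record
      { a∈P  = trans (lookup-transposeSet-right a z P) a∈P
      ; z∉P  = trans (lookup-transposeSet-left a z P) z∉P
      ; P∈𝓒  = εP∈𝓒
      ; εP∈𝓒 = subst (_∈ᶠ 𝓒) (sym (trans (τza≡ε (ε P)) (εε P))) P∈𝓒
      }
      where open Pivot pivot

    Admissible-flip : ∀ {P} → Pivot 𝓒 a z P → Admissible 𝓒 ω a z P → Admissible 𝓒 π z a (ε P)
    Admissible-flip {P} pivot = flipped
      where
      open Pivot pivot

      εP≡ : ε P ≡ (P - a) ⊕ z
      εP≡ = transposeSet-exchange a z P a∈P z∉P

      lookup-εP : ∀ {y} → y ≢ a → y ≢ z → lookup (ε P) y ≡ lookup P y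
      lookup-εP = lookup-transposeSet-other a z P

      flipped : Admissible 𝓒 ω a z P → Admissible 𝓒 π z a (ε P)
      flipped (inj₁ noA) = inj₁ λ {y} y<z y∉εP → let y≢a , y≢z , y<a = π-below-z y<z in
        noA y<a (trans (sym (lookup-εP y≢a y≢z)) y∉εP)
        ∘ subst (_∈ᶠ 𝓒) (trans (cong (λ S → (S - z) ⊕ y) εP≡) (replace-back P a z∉P y≢z))
      flipped (inj₂ noZ) = inj₂ λ {y} y<z y∈εP → let y≢a , y≢z , y<a = π-below-z y<z in
        noZ y<a (trans (sym (lookup-εP y≢a y≢z)) y∈εP)
        ∘ subst (_∈ᶠ 𝓒) (trans (cong (λ S → (S - y) ⊕ a) εP≡) (replace-through P z a∈P y≢a y≢z))

    preimageCount-pivot : BasisExchange 𝓒 → ∀ {P X} → Pivot 𝓒 a z P → Admissible 𝓒 ω a z P → InOrbit P X →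
      preimageCount ω 𝓒 X ≡ preimageCount π 𝓒 (ε X)
    preimageCount-pivot exch {P} pivot adm (inj₁ refl) =
      preimageCount-transport {𝓒 = 𝓒} ε εε Forward.ε-maps-ωpreimages-of-P λ D φπD≡εP →
        subst₂ (λ S T → φ ω 𝓒 S ≡ just T) (τza≡ε D) (trans (τza≡ε (ε P)) (εε P))
               (Backward.ε-maps-ωpreimages-of-P D φπD≡εP)
      where
      module Forward  = PivotPreimages exch sw pivot adm
      module Backward = PivotPreimages exch flip (Pivot-flip pivot) (Admissible-flip pivot adm)
    preimageCount-pivot exch {P} pivot adm (inj₂ refl) =
      trans (preimageCount-transport {𝓒 = 𝓒} ε εε Forward.ε-maps-ωpreimages-of-εP λ D φπD≡P →
               subst (λ S → φ ω 𝓒 S ≡ just (ε P)) (τza≡ε D)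
                     (Backward.ε-maps-ωpreimages-of-εP D (trans φπD≡P (cong just (sym (trans (τza≡ε (ε P)) (εε P)))))))
            (cong (preimageCount π 𝓒) (sym (εε P)))
      where
      module Forward  = PivotPreimages exch sw pivot adm
      module Backward = PivotPreimages exch flip (Pivot-flip pivot) (Admissible-flip pivot adm)

  InOrbit-trans : ∀ {P X Q} → InOrbit P X → InOrbit X Q → InOrbit P Q
  InOrbit-trans X∈orbit (inj₁ refl) = X∈orbit
  InOrbit-trans X∈orbit (inj₂ refl) = InOrbit-ε X∈orbit

  InOrbit-∈ : ∀ {𝓒 P X} → InOrbit P X → X ∈ᶠ 𝓒 → ε X ∈ᶠ 𝓒 → P ∈ᶠ 𝓒 × ε P ∈ᶠ 𝓒
  InOrbit-∈         (inj₁ refl) X∈𝓒 εX∈𝓒 = X∈𝓒 , εX∈𝓒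
  InOrbit-∈ {𝓒} {P} (inj₂ refl) X∈𝓒 εX∈𝓒 = subst (_∈ᶠ 𝓒) (εε P) εX∈𝓒 , X∈𝓒

  pivot-orbit : ∀ {𝓒 P X} → Pivot 𝓒 a z P → InOrbit P X → ε X ∈ᶠ 𝓒 × ε X ≢ X
  pivot-orbit {𝓒} {P} pivot X∈orbit = εX∈𝓒 X∈orbit , εX≢X X∈orbit
    where
    open Pivot pivot

    P≢εP : P ≢ ε P
    P≢εP = ≢-at a a∈P (trans (lookup-transposeSet-left a z P) z∉P)

    εX∈𝓒 : ∀ {X} → InOrbit P X → ε X ∈ᶠ 𝓒
    εX∈𝓒 (inj₁ refl) = εP∈𝓒
    εX∈𝓒 (inj₂ refl) = subst (_∈ᶠ 𝓒) (sym (εε P)) P∈𝓒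

    εX≢X : ∀ {X} → InOrbit P X → ε X ≢ X
    εX≢X (inj₁ refl) = ≢-sym P≢εP
    εX≢X (inj₂ refl) = P≢εP ∘ trans (sym (εε P))

  orient : ∀ X → ε X ≢ X → ∃[ P ] (InOrbit P X × lookup P a ≡ true × lookup P z ≡ false)
  orient X εX≢X with lookup X a in Xa | lookup X z in Xz
  ... | true  | false = X , inj₁ refl , Xa , Xz
  ... | false | true  = ε X , inj₂ (sym (εε X)) , trans (lookup-transposeSet-left a z X) Xz
                                                , trans (lookup-transposeSet-right a z X) Xa
  ... | true  | true  = ⊥-elim (εX≢X (transposeSet-fix a z X (trans Xa (sym Xz))))
  ... | false | false = ⊥-elim (εX≢X (transposeSet-fix a z X (trans Xa (sym Xz))))

  module _ (𝓒 : SetFamily n) where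

    PivotOf : (Subset n → Set) → Subset n → Set
    PivotOf K X = ∃[ P ] (InOrbit P X × Pivot 𝓒 a z P × K P)

    private
      isBranchingWitness : Subset n → Subset n → Bool
      isBranchingWitness C D = isBranching ω π 𝓒 D ∧ (eqM (φ ω 𝓒 D) (just C) ∨ eqM (φ π 𝓒 D) (just C))

    branchingImage⁺ : ∀ {C} D → φ ω 𝓒 D ≢ φ π 𝓒 D → φ ω 𝓒 D ≡ just C ⊎ φ π 𝓒 D ≡ just C →
                      isBranchingImage ω π 𝓒 C ≡ true
    branchingImage⁺ {C} D φω≢φπ image = any-true⁺ (isBranchingWitness C) (∈-allSubsets n D)
      (∧-true⁺ (∧-true⁺ almostBasis (cong not (¬-not (φω≢φπ ∘ eqM-sound))))
               ([ ∨-true⁺ˡ ∘ eqM-just , ∨-true⁺ʳ ∘ eqM-just ] image))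
      where
      almostBasis : isAlmostBasis 𝓒 D ≡ true
      almostBasis = [ φ≡just⇒isAlmostBasis ω 𝓒 D , φ≡just⇒isAlmostBasis π 𝓒 D ] image

    nonBranching-preimageCount : ∀ C → isBranchingImage ω π 𝓒 C ≡ false → preimageCount ω 𝓒 C ≡ preimageCount π 𝓒 C
    nonBranching-preimageCount C notImage = preimageCount-transport {𝓒 = 𝓒} id (λ _ → refl)
      (λ D φωD≡C → trans (sym (φω≡φπ D (inj₁ φωD≡C))) φωD≡C)
      (λ D φπD≡C → trans (φω≡φπ D (inj₂ φπD≡C)) φπD≡C)
      where
      φω≡φπ : ∀ D → φ ω 𝓒 D ≡ just C ⊎ φ π 𝓒 D ≡ just C → φ ω 𝓒 D ≡ φ π 𝓒 D
      φω≡φπ D image with Maybe.≡-dec (Vec.≡-dec Bool._≟_) (φ ω 𝓒 D) (φ π 𝓒 D)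
      ... | yes φω≡φπ = φω≡φπ
      ... | no  φω≢φπ = ⊥-elim (not-¬ (branchingImage⁺ D φω≢φπ image) notImage)

    least-addables-differ : ∀ {D m m′} → LeastAddable ω 𝓒 D m → LeastAddable π 𝓒 D m′ → m ≢ m′ → m ≡ a × m′ ≡ z
    least-addables-differ la la′ m≢m′ = reversed⇒a,z
      (≤∧≢⇒<[] ω (least la (m∉D la′) (D+m∈𝓒 la′)) m≢m′)
      (≤∧≢⇒<[] π (least la′ (m∉D la) (D+m∈𝓒 la)) (≢-sym m≢m′))

    branching-split : ∀ D {C₁ C₂} → φ ω 𝓒 D ≡ just C₁ → φ π 𝓒 D ≡ just C₂ → C₁ ≢ C₂ →
      C₁ ≡ D ⊕ a × C₂ ≡ ε (D ⊕ a) × Pivot 𝓒 a z (D ⊕ a) × NoLowerReplacementOfA 𝓒 ω a (D ⊕ a)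
    branching-split D φωD≡C₁ φπD≡C₂ C₁≢C₂ with φ≡just⇒ ω 𝓒 D φωD≡C₁ | φ≡just⇒ π 𝓒 D φπD≡C₂
    ... | m , la , refl | m′ , la′ , refl with least-addables-differ la la′ (λ { refl → C₁≢C₂ refl })
    ... | refl , refl = refl , sym ε[D⊕a]≡D⊕z , pivot , noLower
      where
      D⊕a-a≡D : (D ⊕ a) - a ≡ D
      D⊕a-a≡D = add-del-cancel D a (m∉D la)

      z∉D⊕a : lookup (D ⊕ a) z ≡ false
      z∉D⊕a = trans (lookup-add-other D (≢-sym a≢z)) (m∉D la′)

      ε[D⊕a]≡D⊕z : ε (D ⊕ a) ≡ D ⊕ z
      ε[D⊕a]≡D⊕z = trans (transposeSet-exchange a z (D ⊕ a) (lookup-add-same D a) z∉D⊕a) (cong (_⊕ z) D⊕a-a≡D)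

      pivot : Pivot 𝓒 a z (D ⊕ a)
      pivot = record
        { a∈P = lookup-add-same D a ; z∉P = z∉D⊕a ; P∈𝓒 = D+m∈𝓒 la
        ; εP∈𝓒 = subst (_∈ᶠ 𝓒) (sym ε[D⊕a]≡D⊕z) (D+m∈𝓒 la′) }

      noLower : NoLowerReplacementOfA 𝓒 ω a (D ⊕ a)
      noLower {y} y<a y∉D⊕a D⊕a-a⊕y∈𝓒 =
        ℕ.<⇒≱ y<a (least la (trans (sym (lookup-add-other D (<[]⇒≢ ω y<a))) y∉D⊕a)
                             (subst (_∈ᶠ 𝓒) (cong (_⊕ y) D⊕a-a≡D) D⊕a-a⊕y∈𝓒))

    branchingImage⇒pivot : ∀ C → isBranchingImage ω π 𝓒 C ≡ true → PivotOf (NoLowerReplacementOfA 𝓒 ω a) C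
    branchingImage⇒pivot C isImage with any-true⁻ (isBranchingWitness C) (allSubsets n) isImage
    ... | D , _ , witness with ∧-true⁻ witness
    ... | branching , image with ∧-true⁻ branching
    ... | almostBasis , φω≢φπ with φ-defined ω 𝓒 D almostBasis | φ-defined π 𝓒 D almostBasis
    ... | C₁ , φωD≡C₁ | C₂ , φπD≡C₂ with branching-split D φωD≡C₁ φπD≡C₂ (eqM-distinct φω≢φπ φωD≡C₁ φπD≡C₂)
    ... | C₁≡D⊕a , C₂≡ε[D⊕a] , pivot , noLower =
      D ⊕ a , [ inj₁ ∘ via φωD≡C₁ C₁≡D⊕a , inj₂ ∘ via φπD≡C₂ C₂≡ε[D⊕a] ] (∨-true⁻ image) , pivot , noLower
      where
      via : ∀ {ρ Cᵢ S} → φ ρ 𝓒 D ≡ just Cᵢ → Cᵢ ≡ S → eqM (φ ρ 𝓒 D) (just C) ≡ true → C ≡ S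
      via φD≡Cᵢ Cᵢ≡S φD≡C = trans (just-injective (trans (sym (eqM-sound φD≡C)) φD≡Cᵢ)) Cᵢ≡S

  noMove-below-a : ∀ {𝓒 P y} → lookup P a ≡ true → NoLowerReplacementOfA 𝓒 ω a P → y <[ ω ] a → ¬ Moves 𝓒 P a y
  noMove-below-a {𝓒} {P} {y} a∈P noA y<a (τP∈𝓒 , τP≢P) with lookup P y in y∈P?
  ... | true  = τP≢P (transposeSet-fix a y P (trans a∈P (sym y∈P?)))
  ... | false = noA y<a y∈P? (subst (_∈ᶠ 𝓒) (transposeSet-exchange a y P a∈P y∈P?) τP∈𝓒)

  noLower-transfer : ∀ {𝓒₁ 𝓒₂ P₁ P₂} → SameMoves 𝓒₁ P₁ 𝓒₂ P₂ → lookup P₁ a ≡ true → NoLowerReplacementOfA 𝓒₁ ω a P₁ →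
    lookup P₂ a ≡ true → NoLowerReplacementOfA 𝓒₂ ω a P₂
  noLower-transfer {𝓒₁} {𝓒₂} {P₂ = P₂} same a∈P₁ noA a∈P₂ {y} y<a y∉P₂ P₂-a⊕y∈𝓒₂ =
    noMove-below-a {𝓒₁} a∈P₁ noA y<a (Equivalence.from (moves⇔ same (≢-sym (<[]⇒≢ ω y<a))) (τP₂∈𝓒₂ , τP₂≢P₂))
    where
    τP₂∈𝓒₂ : transposeSet a y P₂ ∈ᶠ 𝓒₂
    τP₂∈𝓒₂ = subst (_∈ᶠ 𝓒₂) (sym (transposeSet-exchange a y P₂ a∈P₂ y∉P₂)) P₂-a⊕y∈𝓒₂

    τP₂≢P₂ : transposeSet a y P₂ ≢ P₂
    τP₂≢P₂ = ≢-sym (≢-at a a∈P₂ (trans (lookup-transposeSet-left a y P₂) y∉P₂))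

  noZ-transfer : ∀ {𝓒₁ 𝓒₂ P₁ P₂} → SameMoves 𝓒₁ P₁ 𝓒₂ (ε P₂) → lookup P₁ a ≡ true → NoLowerReplacementOfA 𝓒₁ ω a P₁ →
    lookup P₂ a ≡ true → lookup P₂ z ≡ false → NoReplacementOfLowerByZ 𝓒₂ ω a z P₂
  noZ-transfer {𝓒₁} {𝓒₂} {P₂ = P₂} same a∈P₁ noA a∈P₂ z∉P₂ {y} y<a y∈P₂ P₂-y⊕z∈𝓒₂ =
    noMove-below-a {𝓒₁} a∈P₁ noA y<a (Equivalence.from (moves⇔ same (≢-sym y≢a)) (τεP₂∈𝓒₂ , τεP₂≢εP₂))
    where
    y≢a : y ≢ a
    y≢a = proj₁ (below-a⇒≢ y<a)

    y≢z : y ≢ z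
    y≢z = proj₂ (below-a⇒≢ y<a)

    P′ : Subset n
    P′ = (P₂ - a) ⊕ z

    τεP₂≡ : transposeSet a y (ε P₂) ≡ (P₂ - y) ⊕ z
    τεP₂≡ = begin
      transposeSet a y (ε P₂) ≡⟨ cong (transposeSet a y) (transposeSet-exchange a z P₂ a∈P₂ z∉P₂) ⟩
      transposeSet a y P′     ≡⟨ sym (transposeSet-comm a y P′) ⟩
      transposeSet y a P′     ≡⟨ transposeSet-exchange y a P′ y∈P′ a∉P′ ⟩
      (P′ - y) ⊕ a            ≡⟨ replace-through P₂ z a∈P₂ y≢a y≢z ⟩
      (P₂ - y) ⊕ z            ∎
      where
      open ≡-Reasoning
      y∈P′ : lookup P′ y ≡ true
      y∈P′ = trans (lookup-add-other (P₂ - a) y≢z) (trans (lookup-del-other P₂ y≢a) y∈P₂)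
      a∉P′ : lookup P′ a ≡ false
      a∉P′ = trans (lookup-add-other (P₂ - a) a≢z) (lookup-del-same P₂ a)

    τεP₂∈𝓒₂ : transposeSet a y (ε P₂) ∈ᶠ 𝓒₂
    τεP₂∈𝓒₂ = subst (_∈ᶠ 𝓒₂) (sym τεP₂≡) P₂-y⊕z∈𝓒₂

    τεP₂≢εP₂ : transposeSet a y (ε P₂) ≢ ε P₂
    τεP₂≢εP₂ = ≢-at a (trans (lookup-transposeSet-left a y (ε P₂))
                             (trans (lookup-transposeSet-other a z P₂ y≢a y≢z) y∈P₂))
                      (trans (lookup-transposeSet-left a z P₂) z∉P₂)

  admissible-transfer : ∀ {𝓒₁ 𝓒₂ P₁ P₂ Q} → SameMoves 𝓒₁ P₁ 𝓒₂ Q → lookup P₁ a ≡ true →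
    NoLowerReplacementOfA 𝓒₁ ω a P₁ → lookup P₂ a ≡ true → lookup P₂ z ≡ false → InOrbit P₂ Q →
    Admissible 𝓒₂ ω a z P₂
  admissible-transfer same a∈P₁ noA a∈P₂ z∉P₂ (inj₁ refl) = inj₁ (noLower-transfer same a∈P₁ noA a∈P₂)
  admissible-transfer same a∈P₁ noA a∈P₂ z∉P₂ (inj₂ refl) = inj₂ (noZ-transfer same a∈P₁ noA a∈P₂ z∉P₂)

  SameMoves-orbit : ∀ {𝓒₁ 𝓒₂ P₁ X₁ X₂} → SameMoves 𝓒₁ X₁ 𝓒₂ X₂ → SameMoves 𝓒₁ (ε X₁) 𝓒₂ (ε X₂) →
    InOrbit P₁ X₁ → ∃[ Q ] (SameMoves 𝓒₁ P₁ 𝓒₂ Q × InOrbit X₂ Q)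
  SameMoves-orbit {X₂ = X₂} same _ (inj₁ refl) = X₂ , same , inj₁ refl
  SameMoves-orbit {𝓒₁} {𝓒₂} {P₁} {X₂ = X₂} _ sameε (inj₂ refl) =
    ε X₂ , subst (λ S → SameMoves 𝓒₁ S 𝓒₂ (ε X₂)) (εε P₁) sameε , inj₂ refl

  pivot-transfer : ∀ {𝓒₁ 𝓒₂ X₁ X₂} → SameMoves 𝓒₁ X₁ 𝓒₂ X₂ → SameMoves 𝓒₁ (ε X₁) 𝓒₂ (ε X₂) →
    PivotOf 𝓒₁ (NoLowerReplacementOfA 𝓒₁ ω a) X₁ → X₂ ∈ᶠ 𝓒₂ → ε X₂ ∈ᶠ 𝓒₂ → ε X₂ ≢ X₂ →
    PivotOf 𝓒₂ (Admissible 𝓒₂ ω a z) X₂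
  pivot-transfer {𝓒₂ = 𝓒₂} {X₂ = X₂} same sameε (P₁ , X₁∈orbit , pivot₁ , noA) X₂∈𝓒₂ εX₂∈𝓒₂ εX₂≢X₂
    with orient X₂ εX₂≢X₂ | SameMoves-orbit same sameε X₁∈orbit
  ... | P₂ , X₂∈orbit , a∈P₂ , z∉P₂ | Q , sameQ , Q∈orbit =
    P₂ , X₂∈orbit , pivot₂ ,
    admissible-transfer sameQ (Pivot.a∈P pivot₁) noA a∈P₂ z∉P₂ (InOrbit-trans X₂∈orbit Q∈orbit)
    where
    pivot₂ : Pivot 𝓒₂ a z P₂
    pivot₂ = record
      { a∈P = a∈P₂ ; z∉P = z∉P₂
      ; P∈𝓒 = proj₁ (InOrbit-∈ X₂∈orbit X₂∈𝓒₂ εX₂∈𝓒₂) ; εP∈𝓒 = proj₂ (InOrbit-∈ X₂∈orbit X₂∈𝓒₂ εX₂∈𝓒₂) }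

module LinkedCounts {n} {𝓑 𝓑* : SetFamily n} {star : Subset n → Subset n}
  (exch : BasisExchange 𝓑) (exch* : BasisExchange 𝓑*) (linking : IsLinking 𝓑 𝓑* star)
  {ω π : LinOrder n} {a z : Fin n} (sw : AdjacentSwap ω π a z) {B : Subset n} (B∈𝓑 : B ∈ᶠ 𝓑) where

  private
    ε : Subset n → Subset n
    ε = transposeSet a z

    star-injective : ∀ {B₁ B₂} → B₁ ∈ᶠ 𝓑 → B₂ ∈ᶠ 𝓑 → star B₁ ≡ star B₂ → B₁ ≡ B₂
    star-injective = proj₁ (proj₂ linking) _ _

    linked-ε : ε B ∈ᶠ 𝓑 → ε (star B) ∈ᶠ 𝓑* × ε (star B) ≡ star (ε B)
    linked-ε = proj₁ (proj₂ (proj₂ (proj₂ linking))) B a z B∈𝓑 (AdjacentSwap.a≢z sw)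

    linked-ε* : ε (star B) ∈ᶠ 𝓑* → ε B ∈ᶠ 𝓑 × ε (star B) ≡ star (ε B)
    linked-ε* = proj₂ (proj₂ (proj₂ (proj₂ linking))) B a z B∈𝓑 (AdjacentSwap.a≢z sw)

    B*∈𝓑* : star B ∈ᶠ 𝓑*
    B*∈𝓑* = proj₁ linking B B∈𝓑

    sameMoves : ∀ {B′} → B′ ∈ᶠ 𝓑 → SameMoves 𝓑 B′ 𝓑* (star B′)
    sameMoves = linking-sameMoves 𝓑 𝓑* star linking

  Counts : Subset n → Set
  Counts C = preimageCount ω 𝓑 B ≡ preimageCount π 𝓑 C × preimageCount ω 𝓑* (star B) ≡ preimageCount π 𝓑* (star C)

  counts-unswapped : isBranchingImage ω π 𝓑 B ≡ false → isBranchingImage ω π 𝓑* (star B) ≡ false → Counts B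
  counts-unswapped notImage notImage* =
    nonBranching-preimageCount sw 𝓑 B notImage , nonBranching-preimageCount sw 𝓑* (star B) notImage*

  private
    counts-swapped : PivotOf sw 𝓑 (Admissible 𝓑 ω a z) B → PivotOf sw 𝓑* (Admissible 𝓑* ω a z) (star B) →
                     ε (star B) ≡ star (ε B) → Counts (ε B)
    counts-swapped (_ , B∈orbit , pivot , adm) (_ , B*∈orbit , pivot* , adm*) εB*≡ =
      preimageCount-pivot sw exch pivot adm B∈orbit ,
      trans (preimageCount-pivot sw exch* pivot* adm* B*∈orbit) (cong (preimageCount π 𝓑*) εB*≡)

  counts-when-B-branching : isBranchingImage ω π 𝓑 B ≡ true → Counts (ε B)
  counts-when-B-branching isImage = from-pivot (branchingImage⇒pivot sw 𝓑 B isImage)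
    where
    from-pivot : PivotOf sw 𝓑 (NoLowerReplacementOfA 𝓑 ω a) B → Counts (ε B)
    from-pivot pv@(P , B∈orbit , pivot , noA) = counts-swapped (P , B∈orbit , pivot , inj₁ noA) pv* εB*≡
      where
      εB∈𝓑 : ε B ∈ᶠ 𝓑
      εB∈𝓑 = proj₁ (pivot-orbit sw pivot B∈orbit)

      εB*≡ : ε (star B) ≡ star (ε B)
      εB*≡ = proj₂ (linked-ε εB∈𝓑)

      εB*≢B* : ε (star B) ≢ star B
      εB*≢B* εB*≡B* = proj₂ (pivot-orbit sw pivot B∈orbit) (star-injective εB∈𝓑 B∈𝓑 (trans (sym εB*≡) εB*≡B*))

      pv* : PivotOf sw 𝓑* (Admissible 𝓑* ω a z) (star B)
      pv* = pivot-transfer sw (sameMoves B∈𝓑) (subst (SameMoves 𝓑 (ε B) 𝓑*) (sym εB*≡) (sameMoves εB∈𝓑))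
                           pv B*∈𝓑* (proj₁ (linked-ε εB∈𝓑)) εB*≢B*

  counts-when-B*-branching : isBranchingImage ω π 𝓑* (star B) ≡ true → Counts (ε B)
  counts-when-B*-branching isImage* = from-pivot (branchingImage⇒pivot sw 𝓑* (star B) isImage*)
    where
    from-pivot : PivotOf sw 𝓑* (NoLowerReplacementOfA 𝓑* ω a) (star B) → Counts (ε B)
    from-pivot pv*@(P* , B*∈orbit , pivot* , noA*) = counts-swapped pv (P* , B*∈orbit , pivot* , inj₁ noA*) εB*≡
      where
      εB*∈𝓑* : ε (star B) ∈ᶠ 𝓑*
      εB*∈𝓑* = proj₁ (pivot-orbit sw pivot* B*∈orbit)

      εB∈𝓑 : ε B ∈ᶠ 𝓑
      εB∈𝓑 = proj₁ (linked-ε* εB*∈𝓑*)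

      εB*≡ : ε (star B) ≡ star (ε B)
      εB*≡ = proj₂ (linked-ε* εB*∈𝓑*)

      εB≢B : ε B ≢ B
      εB≢B εB≡B = proj₂ (pivot-orbit sw pivot* B*∈orbit) (trans εB*≡ (cong star εB≡B))

      pv : PivotOf sw 𝓑 (Admissible 𝓑 ω a z) B
      pv = pivot-transfer sw (SameMoves-sym (sameMoves B∈𝓑))
                          (SameMoves-sym (subst (SameMoves 𝓑 (ε B) 𝓑*) (sym εB*≡) (sameMoves εB∈𝓑)))
                          pv* B∈𝓑 εB∈𝓑 εB≢B

corollary10p5 : ∀ {n : ℕ} (𝓑 𝓑* : SetFamily n) (star : Subset n → Subset n)
    (ω π : LinOrder n) (a z : Fin n) →
    IsMatroid 𝓑 → IsMatroid 𝓑* → IsLinking 𝓑 𝓑* star →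
    a ≢ z → rank ω z ≡ suc (rank ω a) → SwapOrder ω a z π →
    ∀ B → B ∈ᶠ 𝓑 →
    preimageCount ω 𝓑 B ≡ preimageCount π 𝓑 (σ ω π 𝓑 𝓑* star a z B)
    × preimageCount ω 𝓑* (star B) ≡ preimageCount π 𝓑* (star (σ ω π 𝓑 𝓑* star a z B))
corollary10p5 𝓑 𝓑* star ω π a z (_ , exch) (_ , exch*) linking a≢z z≡1+a swapOrder B B∈𝓑 =
  by-cases (isBranchingImage ω π 𝓑 B) (isBranchingImage ω π 𝓑* (star B)) refl refl
  where
  open LinkedCounts exch exch* linking (adjacentSwap a≢z z≡1+a swapOrder) B∈𝓑

  by-cases : ∀ b b* → isBranchingImage ω π 𝓑 B ≡ b → isBranchingImage ω π 𝓑* (star B) ≡ b* →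
             Counts (if b ∨ b* then transposeSet a z B else B)
  by-cases false false notImage notImage* = counts-unswapped notImage notImage*
  by-cases true  _     isImage  _         = counts-when-B-branching isImage
  by-cases false true  _        isImage*  = counts-when-B*-branching isImage*
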